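{- Let $d\ge 1$. Draw coupons independently and uniformly at random (with replacement) from $d$ types, and let $T_2$ be the first draw at which at least $2$ copies of each of the $d$ types have been obtained. Then \[\mathbb{E}[T_2]=d^2\sum_{m=0}^{d-1}\sum_{j=0}^{m}(-1)^m\binom{d-1}{m}\binom{m}{j}\frac{(j+2)!}{(m+1)^{j+3}}.\] -}

module Defs where

open import Data.Nat as ℕ using (ℕ; zero; suc; NonZero; _^_; _≤_; _!)
open import Data.Nat.Combinatorics using (_C_)
open import Data.Integer as ℤ using (ℤ; +_; -_)
open import Data.Rational as ℚ using (ℚ; 0ℚ; _/_)
open import Data.Fin using (Fin; _≟_)
open import Data.List using (List; []; _∷_; map; concatMap; length; filter; allFin)
open import Data.Bool.ListAction using (and)
open import Data.Bool using (Bool; true; false; _∧_; not)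
open import Data.Nat.Properties using (m^n≢0)
open import Data.Product using (∃)
open import Relation.Nullary using (does)
open import Relation.Nullary.Decidable using (⌊_⌋)

-- Draw sequences of length n over d coupon types, as lists of Fin d.
-- All d^n sequences of length n (each equally likely under the uniform
-- product distribution).
allSeqs : (d : ℕ) → ℕ → List (List (Fin d))
allSeqs d zero    = [] ∷ []
allSeqs d (suc n) = concatMap (λ w → map (λ c → c ∷ w) (allFin d)) (allSeqs d n)

copies : {d : ℕ} → Fin d → List (Fin d) → ℕ
copies i []      = 0
copies i (c ∷ w) with does (i ≟ c)
... | true  = suc (copies i w)
... | false = copies i w

atLeastTwo : ℕ → Bool
atLeastTwo (suc (suc _)) = true
atLeastTwo _             = false

complete : (d : ℕ) → List (Fin d) → Bool
complete d w = and (map (λ i → atLeastTwo (copies i w)) (allFin d))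

-- all but the last draw (sequences are listed in draw order: head = first draw)
dropLast : {A : Set} → List A → List A
dropLast []          = []
dropLast (x ∷ [])    = []
dropLast (x ∷ y ∷ w) = x ∷ dropLast (y ∷ w)

-- T₂ = n for the draw sequence w of length n: complete after n draws but
-- not after n-1 draws (for n = 0 this is false unless d = 0).
stopsExactly : (d : ℕ) → ℕ → List (Fin d) → Bool
stopsExactly d zero    w = complete d w
stopsExactly d (suc n) w = complete d w ∧ not (complete d (dropLast w))

probT₂ : (d : ℕ) → .{{NonZero d}} → ℕ → ℚ
probT₂ d n =
  (+ length (filter (λ w → Data.Bool._≟_ (stopsExactly d n w) true) (allSeqs d n)))
    / (d ^ n)
  where import Data.Bool
        instance _ = m^n≢0 d n

sumTo : ℕ → (ℕ → ℚ) → ℚ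
sumTo zero    f = f 0
sumTo (suc n) f = sumTo n f ℚ.+ f (suc n)

SeriesSumsTo : (ℕ → ℚ) → ℚ → Set
SeriesSumsTo a L =
  (ε : ℚ) → 0ℚ ℚ.< ε → ∃ λ N → (n : ℕ) → N ≤ n → ℚ.∣ sumTo n a ℚ.- L ∣ ℚ.< ε

ExpectationT₂Is : (d : ℕ) → .{{NonZero d}} → ℚ → Set
ExpectationT₂Is d L = SeriesSumsTo (λ n → ((+ n) / 1) ℚ.* probT₂ d n) L

-- integer / natural, used only with positive denominators ((m+1)^(j+3) ≥ 1)
_//_ : ℤ → ℕ → ℚ
n // zero  = 0ℚ
n // suc e = n / suc e

sign : ℕ → ℤ
sign zero    = + 1
sign (suc m) = - sign m

formula : ℕ → ℚ
formula zero    = 0ℚ   -- unused (d ≥ 1)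
formula (suc k) =
  ((+ (suc k ^ 2)) / 1) ℚ.*
    sumTo k (λ m → sumTo m (λ j →
      (sign m ℤ.* (+ ((k C m) ℕ.* (m C j) ℕ.* ((j ℕ.+ 2) !))))
        // (suc m ^ (j ℕ.+ 3))))

-- Write d = k + 1 and χ≥2 n = [n ≥ 2], whose exponential generating function is
-- eˣ - 1 - x.  Counting words by letter multiplicities, the number of words of
-- length n in which every letter occurs at least twice is n! [xⁿ] (eˣ - 1 - x)ᵈ.
-- A word of length n+1 stops at its last letter iff it is complete but its prefix
-- is not, which gives #{T₂ = n+1} = d · n! [xⁿ] x (eˣ - 1 - x)ᵏ.  Expanding
-- (eˣ - 1 - x)ᵏ = ∑ₘ ∑ⱼ (-1)ᵐ C(k,m) C(m,j) xʲ e⁽ᵏ⁻ᵐ⁾ˣ writes n P(T₂ = n) as a finite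
-- combination of the terms n(n-1)⋯(n-i+1) rⁿ⁻ⁱ / dⁿ (i = j + 2, r = k - m), and
-- ∑ₙ n(n-1)⋯(n-i+1) rⁿ⁻ⁱ / dⁿ = i! d / (d - r)ⁱ⁺¹.  The partial sums of each such
-- series are within O(1/N) of the limit, by a negative binomial tail estimate, and
-- this rate survives finite linear combinations, which gives convergence in ℚ.

{-# OPTIONS --safe #-}
module Submission where

open import Defs
open import Algebra.Bundles using (CommutativeSemiring)
open import Data.Nat as ℕ using (ℕ; zero; suc; NonZero; z≤n; s≤s)
import Data.Nat.Properties as ℕₚ
open import Function using (_∘_)

module RangeSum {c ℓ} (R : CommutativeSemiring c ℓ) where

  open CommutativeSemiring R
  open import Algebra.Properties.CommutativeSemigroup +-commutativeSemigroup
    using (interchange)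
  open import Relation.Binary.Reasoning.Setoid setoid

  ∑≤ : ℕ → (ℕ → Carrier) → Carrier
  ∑≤ zero    f = f 0
  ∑≤ (suc K) f = ∑≤ K f + f (suc K)

  syntax ∑≤ K (λ i → x) = ∑[ i ≤ K ] x

  ∑≤-cong : ∀ K {f g} → (∀ i → i ℕ.≤ K → f i ≈ g i) → ∑≤ K f ≈ ∑≤ K g
  ∑≤-cong zero    f≈g = f≈g 0 z≤n
  ∑≤-cong (suc K) f≈g =
    +-cong (∑≤-cong K λ i i≤K → f≈g i (ℕₚ.m≤n⇒m≤1+n i≤K)) (f≈g (suc K) ℕₚ.≤-refl)

  ∑≤-distrib-+ : ∀ K (f g : ℕ → Carrier) → ∑[ i ≤ K ] (f i + g i) ≈ ∑≤ K f + ∑≤ K g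
  ∑≤-distrib-+ zero    f g = refl
  ∑≤-distrib-+ (suc K) f g = trans (+-congʳ (∑≤-distrib-+ K f g)) (interchange _ _ _ _)

  *-distribˡ-∑≤ : ∀ K x (f : ℕ → Carrier) → x * ∑≤ K f ≈ ∑[ i ≤ K ] (x * f i)
  *-distribˡ-∑≤ zero    x f = refl
  *-distribˡ-∑≤ (suc K) x f = trans (distribˡ x _ _) (+-congʳ (*-distribˡ-∑≤ K x f))

  ∑≤-comm : ∀ M N (f : ℕ → ℕ → Carrier) →
            ∑[ i ≤ M ] ∑[ j ≤ N ] f i j ≈ ∑[ j ≤ N ] ∑[ i ≤ M ] f i j
  ∑≤-comm zero    N f = refl
  ∑≤-comm (suc M) N f =
    trans (+-congʳ (∑≤-comm M N f)) (sym (∑≤-distrib-+ N (λ j → ∑[ i ≤ M ] f i j) (f (suc M))))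

  ∑≤-split-head : ∀ K (f : ℕ → Carrier) → ∑≤ (suc K) f ≈ f 0 + ∑[ i ≤ K ] f (suc i)
  ∑≤-split-head zero    f = refl
  ∑≤-split-head (suc K) f = trans (+-congʳ (∑≤-split-head K f)) (+-assoc _ _ _)

module BinomialConvolution where

  open import Data.Integer using (ℤ; +_; -_; _+_; _-_; _*_)
  import Data.Integer.Properties as ℤₚ
  open import Data.Integer.Tactic.RingSolver using (solve-∀)
  open import Relation.Binary.PropositionalEquality
  open import Algebra.Properties.CommutativeSemigroup ℤₚ.+-commutativeSemigroup
    using () renaming (interchange to +-interchange; x∙yz≈y∙xz to +-leftSwap)
  open import Algebra.Properties.CommutativeSemigroup ℤₚ.*-commutativeSemigroup
    using () renaming (x∙yz≈y∙xz to *-leftSwap)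
  open import Algebra.Properties.Ring ℤₚ.+-*-ring using ([y-z]x≈yx-zx)
  open RangeSum ℤₚ.+-*-commutativeSemiring public

  Seq : Set
  Seq = ℕ → ℤ

  shift : Seq → Seq
  shift a n = a (suc n)

  infixl 6 _+ₛ_ _-ₛ_
  infixl 7 _⋆_
  infixr 7 _·ₛ_
  infixr 8 x·_

  _+ₛ_ _-ₛ_ : Seq → Seq → Seq
  (a +ₛ b) n = a n + b n
  (a -ₛ b) n = a n - b n

  _·ₛ_ : ℤ → Seq → Seq
  (k ·ₛ a) n = k * a n

  -- A sequence a stands for its exponential generating function ∑ₙ a n xⁿ/n!,
  -- so that shift is d/dx.  The product of two such functions is the binomial
  -- convolution (a ⋆ b) n = ∑ₖ C(n,k) a k b (n ∸ k), computed here by the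
  -- Leibniz rule shift (a ⋆ b) = shift a ⋆ b + a ⋆ shift b; x· is
  -- multiplication by x, and 1ₛ, eˣ are the functions 1 and eˣ.
  _⋆_ : Seq → Seq → Seq
  (a ⋆ b) zero    = a 0 * b 0
  (a ⋆ b) (suc n) = (shift a ⋆ b) n + (a ⋆ shift b) n

  x·_ : Seq → Seq
  (x· a) n = + n * a (ℕ.pred n)

  0ₛ 1ₛ eˣ : Seq
  0ₛ _ = + 0
  1ₛ zero    = + 1
  1ₛ (suc _) = + 0
  eˣ _ = + 1

  ⋆-cong : ∀ {a a′ b b′} → a ≗ a′ → b ≗ b′ → a ⋆ b ≗ a′ ⋆ b′
  ⋆-cong a≗a′ b≗b′ zero    = cong₂ _*_ (a≗a′ 0) (b≗b′ 0)
  ⋆-cong a≗a′ b≗b′ (suc n) =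
    cong₂ _+_ (⋆-cong (a≗a′ ∘ suc) b≗b′ n) (⋆-cong a≗a′ (b≗b′ ∘ suc) n)

  ⋆-comm : ∀ a b → a ⋆ b ≗ b ⋆ a
  ⋆-comm a b zero    = ℤₚ.*-comm (a 0) (b 0)
  ⋆-comm a b (suc n) =
    trans (cong₂ _+_ (⋆-comm (shift a) b n) (⋆-comm a (shift b) n))
          (ℤₚ.+-comm ((b ⋆ shift a) n) ((shift b ⋆ a) n))

  ⋆-distribʳ-- : ∀ a b c → (a -ₛ b) ⋆ c ≗ a ⋆ c -ₛ b ⋆ c
  ⋆-distribʳ-- a b c zero    = [y-z]x≈yx-zx (c 0) (a 0) (b 0)
  ⋆-distribʳ-- a b c (suc n) =
    trans (cong₂ _+_ (⋆-distribʳ-- (shift a) (shift b) c n) (⋆-distribʳ-- a b (shift c) n))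
          (interchange-- ((shift a ⋆ c) n) ((shift b ⋆ c) n) ((a ⋆ shift c) n) ((b ⋆ shift c) n))
    where
    interchange-- : ∀ x y z w → (x - y) + (z - w) ≡ (x + z) - (y + w)
    interchange-- = solve-∀

  ⋆-distribˡ-+ : ∀ a b c → a ⋆ (b +ₛ c) ≗ a ⋆ b +ₛ a ⋆ c
  ⋆-distribˡ-+ a b c zero    = ℤₚ.*-distribˡ-+ (a 0) (b 0) (c 0)
  ⋆-distribˡ-+ a b c (suc n) =
    trans (cong₂ _+_ (⋆-distribˡ-+ (shift a) b c n) (⋆-distribˡ-+ a (shift b) (shift c) n))
          (+-interchange ((shift a ⋆ b) n) ((shift a ⋆ c) n) ((a ⋆ shift b) n) ((a ⋆ shift c) n))

  ⋆-distribʳ-+ : ∀ a b c → (a +ₛ b) ⋆ c ≗ a ⋆ c +ₛ b ⋆ c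
  ⋆-distribʳ-+ a b c n = begin
    ((a +ₛ b) ⋆ c) n       ≡⟨ ⋆-comm (a +ₛ b) c n ⟩
    (c ⋆ (a +ₛ b)) n       ≡⟨ ⋆-distribˡ-+ c a b n ⟩
    (c ⋆ a) n + (c ⋆ b) n  ≡⟨ cong₂ _+_ (⋆-comm c a n) (⋆-comm c b n) ⟩
    (a ⋆ c) n + (b ⋆ c) n  ∎
    where open ≡-Reasoning

  ⋆-·ₛ : ∀ k a b → a ⋆ (k ·ₛ b) ≗ k ·ₛ (a ⋆ b)
  ⋆-·ₛ k a b zero    = *-leftSwap (a 0) k (b 0)
  ⋆-·ₛ k a b (suc n) =
    trans (cong₂ _+_ (⋆-·ₛ k (shift a) b n) (⋆-·ₛ k a (shift b) n))
          (sym (ℤₚ.*-distribˡ-+ k _ _))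

  ⋆-zeroˡ : ∀ b → 0ₛ ⋆ b ≗ 0ₛ
  ⋆-zeroˡ b zero    = refl
  ⋆-zeroˡ b (suc n) = cong₂ _+_ (⋆-zeroˡ b n) (⋆-zeroˡ (shift b) n)

  ⋆-identityˡ : ∀ b → 1ₛ ⋆ b ≗ b
  ⋆-identityˡ b zero    = ℤₚ.*-identityˡ (b 0)
  ⋆-identityˡ b (suc n) =
    trans (cong₂ _+_ (⋆-zeroˡ b n) (⋆-identityˡ (shift b) n)) (ℤₚ.+-identityˡ (b (suc n)))

  ⋆-∑≤ : ∀ K a (b : ℕ → Seq) →
         a ⋆ (λ n → ∑[ i ≤ K ] b i n) ≗ (λ n → ∑[ i ≤ K ] (a ⋆ b i) n)
  ⋆-∑≤ zero    a b n = refl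
  ⋆-∑≤ (suc K) a b n =
    trans (⋆-distribˡ-+ a (λ m → ∑[ i ≤ K ] b i m) (b (suc K)) n)
          (cong (_+ (a ⋆ b (suc K)) n) (⋆-∑≤ K a b n))

  x·-cong : ∀ {a b} → a ≗ b → x· a ≗ x· b
  x·-cong a≗b n = cong (+ n *_) (a≗b (ℕ.pred n))

  x·-·ₛ : ∀ k a → x· (k ·ₛ a) ≗ k ·ₛ x· a
  x·-·ₛ k a n = *-leftSwap (+ n) k (a (ℕ.pred n))

  x·-∑≤ : ∀ K (c : ℕ → ℤ) (a : ℕ → Seq) →
          x· (λ n → ∑[ i ≤ K ] (c i * a i n)) ≗ (λ n → ∑[ i ≤ K ] (c i * (x· a i) n))
  x·-∑≤ K c a n =
    trans (*-distribˡ-∑≤ K (+ n) (λ i → c i * a i (ℕ.pred n)))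
          (∑≤-cong K (λ i _ → *-leftSwap (+ n) (c i) (a i (ℕ.pred n))))

  shift-x· : ∀ a → shift (x· a) ≗ a +ₛ x· shift a
  shift-x· a zero    = trans (ℤₚ.*-identityˡ (a 0)) (sym (ℤₚ.+-identityʳ (a 0)))
  shift-x· a (suc n) = ℤₚ.suc-* (+ suc n) (a (suc n))

  ⋆-x· : ∀ a b → a ⋆ x· b ≗ x· (a ⋆ b)
  ⋆-x· a b zero    = ℤₚ.*-zeroʳ (a 0)
  ⋆-x· a b (suc n) = begin
    (shift a ⋆ x· b) n + (a ⋆ shift (x· b)) n
      ≡⟨ cong₂ _+_ (⋆-x· (shift a) b n) (⋆-cong (λ _ → refl) (shift-x· b) n) ⟩
    (x· (shift a ⋆ b)) n + (a ⋆ (b +ₛ x· shift b)) n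
      ≡⟨ cong (_+_ ((x· (shift a ⋆ b)) n)) (⋆-distribˡ-+ a b (x· shift b) n) ⟩
    (x· (shift a ⋆ b)) n + ((a ⋆ b) n + (a ⋆ x· shift b) n)
      ≡⟨ cong (λ t → (x· (shift a ⋆ b)) n + ((a ⋆ b) n + t)) (⋆-x· a (shift b) n) ⟩
    (x· (shift a ⋆ b)) n + ((a ⋆ b) n + (x· (a ⋆ shift b)) n)
      ≡⟨ +-leftSwap ((x· (shift a ⋆ b)) n) ((a ⋆ b) n) ((x· (a ⋆ shift b)) n) ⟩
    (a ⋆ b) n + ((x· (shift a ⋆ b)) n + (x· (a ⋆ shift b)) n)
      ≡⟨ cong (_+_ ((a ⋆ b) n)) (sym (ℤₚ.*-distribˡ-+ (+ n) _ _)) ⟩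
    (a ⋆ b) n + (x· shift (a ⋆ b)) n
      ≡⟨ sym (shift-x· (a ⋆ b) n) ⟩
    (x· (a ⋆ b)) (suc n)
      ∎
    where open ≡-Reasoning

  x·1ₛ-⋆ : ∀ b → x· 1ₛ ⋆ b ≗ x· b
  x·1ₛ-⋆ b n = begin
    (x· 1ₛ ⋆ b) n      ≡⟨ ⋆-comm (x· 1ₛ) b n ⟩
    (b ⋆ x· 1ₛ) n      ≡⟨ ⋆-x· b 1ₛ n ⟩
    (x· (b ⋆ 1ₛ)) n    ≡⟨ x·-cong (λ m → trans (⋆-comm b 1ₛ m) (⋆-identityˡ b m)) n ⟩
    (x· b) n           ∎
    where open ≡-Reasoning

  -- powExp j r is the generating function xʲ eʳˣ, i.e. n ↦ n (n-1) ⋯ (n-j+1) rⁿ⁻ʲ.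
  powExp : ℕ → ℕ → Seq
  powExp zero    r n = + (r ℕ.^ n)
  powExp (suc j) r   = x· powExp j r

  eˣ⋆powExp : ∀ j r → eˣ ⋆ powExp j r ≗ powExp j (suc r)
  eˣ⋆powExp zero    r zero    = refl
  eˣ⋆powExp zero    r (suc n) = begin
    (eˣ ⋆ powExp 0 r) n + (eˣ ⋆ shift (powExp 0 r)) n
      ≡⟨ cong (_+_ ((eˣ ⋆ powExp 0 r) n)) (⋆-cong (λ _ → refl) (λ m → ℤₚ.pos-* r (r ℕ.^ m)) n) ⟩
    (eˣ ⋆ powExp 0 r) n + (eˣ ⋆ (+ r ·ₛ powExp 0 r)) n
      ≡⟨ cong (_+_ ((eˣ ⋆ powExp 0 r) n)) (⋆-·ₛ (+ r) eˣ (powExp 0 r) n) ⟩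
    (eˣ ⋆ powExp 0 r) n + + r * (eˣ ⋆ powExp 0 r) n
      ≡⟨ sym (ℤₚ.suc-* (+ r) ((eˣ ⋆ powExp 0 r) n)) ⟩
    + suc r * (eˣ ⋆ powExp 0 r) n
      ≡⟨ cong (+ suc r *_) (eˣ⋆powExp 0 r n) ⟩
    + suc r * + (suc r ℕ.^ n)
      ≡⟨ sym (ℤₚ.pos-* (suc r) _) ⟩
    powExp 0 (suc r) (suc n)
      ∎
    where open ≡-Reasoning
  eˣ⋆powExp (suc j) r n = trans (⋆-x· eˣ (powExp j r) n) (x·-cong (eˣ⋆powExp j r) n)

module WordSums where

  open BinomialConvolution
  open import Data.Integer using (ℤ; +_; _+_; _*_)
  import Data.Integer.Properties as ℤₚ
  open import Data.Fin using (Fin; _≟_) renaming (zero to fzero; suc to fsuc)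
  open import Data.List using (List; []; _∷_; _∷ʳ_; _++_; map; concatMap; foldr; allFin; tabulate)
  import Data.List.Properties as Listₚ
  open import Data.Bool using (true; false; if_then_else_)
  open import Relation.Nullary using (does)
  open import Algebra.Properties.Semiring.Sum ℤₚ.+-*-semiring
    using (sum; sum-cong-≗; ∑-distrib-+; ∑-comm; *-distribˡ-sum)
  open import Algebra.Properties.Monoid.Sum ℤₚ.*-1-monoid
    using () renaming (sum to ∏; sum-cong-≗ to ∏-cong-≗)
  open import Relation.Binary.PropositionalEquality

  sum-const : ∀ d x → sum {d} (λ _ → x) ≡ + d * x
  sum-const zero    x = sym (ℤₚ.*-zeroˡ x)
  sum-const (suc d) x = trans (cong (_+_ x) (sum-const d x)) (sym (ℤₚ.suc-* (+ d) x))

  sumᴸ : List ℤ → ℤ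
  sumᴸ = foldr _+_ (+ 0)

  sumᴸ-++ : ∀ xs ys → sumᴸ (xs ++ ys) ≡ sumᴸ xs + sumᴸ ys
  sumᴸ-++ []       ys = sym (ℤₚ.+-identityˡ (sumᴸ ys))
  sumᴸ-++ (x ∷ xs) ys = trans (cong (_+_ x) (sumᴸ-++ xs ys)) (sym (ℤₚ.+-assoc x _ _))

  sumᴸ-concatMap : ∀ {A B : Set} (F : B → ℤ) (h : A → List B) xs →
                   sumᴸ (map F (concatMap h xs)) ≡ sumᴸ (map (λ x → sumᴸ (map F (h x))) xs)
  sumᴸ-concatMap F h []       = refl
  sumᴸ-concatMap F h (x ∷ xs) = begin
    sumᴸ (map F (h x ++ concatMap h xs))
      ≡⟨ cong sumᴸ (Listₚ.map-++ F (h x) (concatMap h xs)) ⟩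
    sumᴸ (map F (h x) ++ map F (concatMap h xs))
      ≡⟨ sumᴸ-++ (map F (h x)) _ ⟩
    sumᴸ (map F (h x)) + sumᴸ (map F (concatMap h xs))
      ≡⟨ cong (_+_ (sumᴸ (map F (h x)))) (sumᴸ-concatMap F h xs) ⟩
    sumᴸ (map (λ x → sumᴸ (map F (h x))) (x ∷ xs))
      ∎
    where open ≡-Reasoning

  sumᴸ-map-cong : ∀ {A : Set} {F G : A → ℤ} → F ≗ G → ∀ xs → sumᴸ (map F xs) ≡ sumᴸ (map G xs)
  sumᴸ-map-cong F≗G []       = refl
  sumᴸ-map-cong F≗G (x ∷ xs) = cong₂ _+_ (F≗G x) (sumᴸ-map-cong F≗G xs)

  sumᴸ-tabulate : ∀ {d} (F : Fin d → ℤ) → sumᴸ (tabulate F) ≡ sum F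
  sumᴸ-tabulate {zero}  F = refl
  sumᴸ-tabulate {suc d} F = cong (_+_ (F fzero)) (sumᴸ-tabulate (F ∘ fsuc))

  sumᴸ-allFin : ∀ {d} (F : Fin d → ℤ) → sumᴸ (map F (allFin d)) ≡ sum F
  sumᴸ-allFin F = trans (cong sumᴸ (Listₚ.map-tabulate (λ i → i) F)) (sumᴸ-tabulate F)

  wordSum : (d n : ℕ) → (List (Fin d) → ℤ) → ℤ
  wordSum d zero    F = F []
  wordSum d (suc n) F = wordSum d n (λ w → sum (λ c → F (c ∷ w)))

  sumᴸ-allSeqs : ∀ d n (F : List (Fin d) → ℤ) → sumᴸ (map F (allSeqs d n)) ≡ wordSum d n F
  sumᴸ-allSeqs d zero    F = ℤₚ.+-identityʳ (F [])
  sumᴸ-allSeqs d (suc n) F = begin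
    sumᴸ (map F (concatMap (λ w → map (_∷ w) (allFin d)) (allSeqs d n)))
      ≡⟨ sumᴸ-concatMap F (λ w → map (_∷ w) (allFin d)) (allSeqs d n) ⟩
    sumᴸ (map (λ w → sumᴸ (map F (map (_∷ w) (allFin d)))) (allSeqs d n))
      ≡⟨ sumᴸ-map-cong (λ w → trans (cong sumᴸ (sym (Listₚ.map-∘ (allFin d))))
                                    (sumᴸ-allFin (λ c → F (c ∷ w)))) (allSeqs d n) ⟩
    sumᴸ (map (λ w → sum (λ c → F (c ∷ w))) (allSeqs d n))
      ≡⟨ sumᴸ-allSeqs d n _ ⟩
    wordSum d (suc n) F
      ∎
    where open ≡-Reasoning

  wordSum-cong : ∀ {d} n {F G : List (Fin d) → ℤ} → F ≗ G → wordSum d n F ≡ wordSum d n G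
  wordSum-cong zero    F≗G = F≗G []
  wordSum-cong (suc n) F≗G = wordSum-cong n (λ w → sum-cong-≗ (λ c → F≗G (c ∷ w)))

  wordSum-distrib-+ : ∀ {d} n (F G : List (Fin d) → ℤ) →
                      wordSum d n (λ w → F w + G w) ≡ wordSum d n F + wordSum d n G
  wordSum-distrib-+ zero    F G = refl
  wordSum-distrib-+ (suc n) F G =
    trans (wordSum-cong n (λ w → ∑-distrib-+ (λ c → F (c ∷ w)) (λ c → G (c ∷ w))))
          (wordSum-distrib-+ n _ _)

  wordSum-*ˡ : ∀ {d} n k (F : List (Fin d) → ℤ) → wordSum d n (λ w → k * F w) ≡ k * wordSum d n F
  wordSum-*ˡ zero    k F = refl
  wordSum-*ˡ (suc n) k F =
    trans (wordSum-cong n (λ w → sym (*-distribˡ-sum k (λ c → F (c ∷ w))))) (wordSum-*ˡ n k _)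

  wordSum-sum : ∀ {d e} n (F : Fin e → List (Fin d) → ℤ) →
                wordSum d n (λ w → sum (λ c → F c w)) ≡ sum (λ c → wordSum d n (F c))
  wordSum-sum zero    F = refl
  wordSum-sum {d} {e} (suc n) F =
    trans (wordSum-cong n (λ w → ∑-comm {d} {e} (λ c′ c → F c (c′ ∷ w))))
          (wordSum-sum n (λ c w → sum (λ c′ → F c (c′ ∷ w))))

  wordSum-snoc : ∀ {d} n (F : List (Fin d) → ℤ) →
                 wordSum d (suc n) F ≡ wordSum d n (λ v → sum (λ c → F (v ∷ʳ c)))
  wordSum-snoc zero    F = refl
  wordSum-snoc (suc n) F =
    trans (wordSum-snoc n (λ u → sum (λ c′ → F (c′ ∷ u))))
          (wordSum-cong n (λ v → ∑-comm (λ c c′ → F (c′ ∷ (v ∷ʳ c)))))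

  shiftAt : ∀ {d} → Fin d → (Fin d → Seq) → Fin d → Seq
  shiftAt c φ i = if does (i ≟ c) then shift (φ i) else φ i

  weight : ∀ {d} → (Fin d → Seq) → List (Fin d) → ℤ
  weight φ w = ∏ (λ i → φ i (copies i w))

  weight-∷ : ∀ {d} (φ : Fin d → Seq) c w → weight φ (c ∷ w) ≡ weight (shiftAt c φ) w
  weight-∷ φ c w = ∏-cong-≗ copies-∷
    where
    copies-∷ : ∀ i → φ i (copies i (c ∷ w)) ≡ shiftAt c φ i (copies i w)
    copies-∷ i with does (i ≟ c)
    ... | true  = refl
    ... | false = refl

  ⋆-product : ∀ {d} → (Fin d → Seq) → Seq
  ⋆-product {zero}  φ = 1ₛ
  ⋆-product {suc d} φ = φ fzero ⋆ ⋆-product (φ ∘ fsuc)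

  ⋆-product-at-0 : ∀ {d} (φ : Fin d → Seq) → ⋆-product φ 0 ≡ ∏ (λ i → φ i 0)
  ⋆-product-at-0 {zero}  φ = refl
  ⋆-product-at-0 {suc d} φ = cong (φ fzero 0 *_) (⋆-product-at-0 (φ ∘ fsuc))

  ⋆-sum : ∀ {e} a (b : Fin e → Seq) →
          a ⋆ (λ n → sum (λ c → b c n)) ≗ (λ n → sum (λ c → (a ⋆ b c) n))
  ⋆-sum {zero}  a b n = trans (⋆-comm a 0ₛ n) (⋆-zeroˡ a n)
  ⋆-sum {suc e} a b n =
    trans (⋆-distribˡ-+ a (b fzero) (λ m → sum (λ c → b (fsuc c) m)) n)
          (cong (_+_ ((a ⋆ b fzero) n)) (⋆-sum a (b ∘ fsuc) n))

  shift-⋆-product : ∀ {d} (φ : Fin d → Seq) →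
                    shift (⋆-product φ) ≗ (λ n → sum (λ c → ⋆-product (shiftAt c φ) n))
  shift-⋆-product {zero}  φ n = refl
  shift-⋆-product {suc d} φ n =
    cong (_+_ ((shift (φ fzero) ⋆ ⋆-product (φ ∘ fsuc)) n))
         (trans (⋆-cong (λ _ → refl) (shift-⋆-product (φ ∘ fsuc)) n)
                (⋆-sum (φ fzero) (λ c → ⋆-product (shiftAt c (φ ∘ fsuc))) n))

  -- Both sides obey the same recursion in n: prepending the letter c shifts the
  -- c-th factor of the weight, which is the Leibniz rule for the product.
  wordSum-weight : ∀ {d} n (φ : Fin d → Seq) → wordSum d n (weight φ) ≡ ⋆-product φ n
  wordSum-weight zero    φ = sym (⋆-product-at-0 φ)
  wordSum-weight (suc n) φ = begin
    wordSum _ n (λ w → sum (λ c → weight φ (c ∷ w)))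
      ≡⟨ wordSum-cong n (λ w → sum-cong-≗ (λ c → weight-∷ φ c w)) ⟩
    wordSum _ n (λ w → sum (λ c → weight (shiftAt c φ) w))
      ≡⟨ wordSum-sum n (λ c → weight (shiftAt c φ)) ⟩
    sum (λ c → wordSum _ n (weight (shiftAt c φ)))
      ≡⟨ sum-cong-≗ (λ c → wordSum-weight n (shiftAt c φ)) ⟩
    sum (λ c → ⋆-product (shiftAt c φ) n)
      ≡⟨ sym (shift-⋆-product φ n) ⟩
    ⋆-product φ (suc n)
      ∎
    where open ≡-Reasoning

module StoppingCount where

  open BinomialConvolution
  open WordSums
  open import Data.Integer using (ℤ; +_; _+_; _*_)
  import Data.Integer.Properties as ℤₚ
  open import Algebra.Bundles using (AbelianGroup)
  open import Algebra.Properties.Group (AbelianGroup.group ℤₚ.+-0-abelianGroup)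
    using () renaming (∙-cancelʳ to +-cancelʳ)
  open import Algebra.Properties.Semiring.Sum ℤₚ.+-*-semiring
    using (sum; sum-cong-≗; ∑-distrib-+)
  open import Algebra.Properties.Monoid.Sum ℤₚ.*-1-monoid using () renaming (sum to ∏)
  open import Data.Fin using (Fin; _≟_) renaming (zero to fzero; suc to fsuc)
  open import Data.List using (List; []; _∷_; _∷ʳ_; map; length; filter; allFin; tabulate)
  import Data.List.Properties as Listₚ
  open import Data.Bool using (Bool; true; false; _∧_; not)
  import Data.Bool as Bool
  open import Data.Bool.ListAction using (and)
  open import Relation.Nullary using (does)
  open import Relation.Binary.PropositionalEquality

  ⟦_⟧ : Bool → ℤ
  ⟦ true  ⟧ = + 1
  ⟦ false ⟧ = + 0

  χ≥2 : Seq
  χ≥2 n = ⟦ atLeastTwo n ⟧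

  infixr 8 _^⋆_
  _^⋆_ : Seq → ℕ → Seq
  a ^⋆ k = ⋆-product {k} (λ _ → a)

  ⟦and⟧ : ∀ {d} (p : Fin d → Bool) → ⟦ and (tabulate p) ⟧ ≡ ∏ (λ i → ⟦ p i ⟧)
  ⟦and⟧ {zero}  p = refl
  ⟦and⟧ {suc d} p with p fzero
  ... | true  = trans (⟦and⟧ (p ∘ fsuc)) (sym (ℤₚ.*-identityˡ _))
  ... | false = refl

  ⟦complete⟧ : ∀ d w → ⟦ complete d w ⟧ ≡ weight (λ _ → χ≥2) w
  ⟦complete⟧ d w =
    trans (cong (λ bs → ⟦ and bs ⟧) (Listₚ.map-tabulate (λ i → i) (λ i → atLeastTwo (copies i w))))
          (⟦and⟧ (λ i → atLeastTwo (copies i w)))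

  copies-∷ʳ : ∀ {d} (i : Fin d) v c → copies i v ℕ.≤ copies i (v ∷ʳ c)
  copies-∷ʳ i []      c = z≤n
  copies-∷ʳ i (x ∷ v) c with does (i ≟ x)
  ... | true  = s≤s (copies-∷ʳ i v c)
  ... | false = copies-∷ʳ i v c

  atLeastTwo-mono : ∀ {m n} → m ℕ.≤ n → atLeastTwo m ≡ true → atLeastTwo n ≡ true
  atLeastTwo-mono (s≤s (s≤s _)) _ = refl

  and-mono : ∀ {A : Set} {p q : A → Bool} → (∀ x → p x ≡ true → q x ≡ true) →
             ∀ xs → and (map p xs) ≡ true → and (map q xs) ≡ true
  and-mono p⇒q []       _ = refl
  and-mono {p = p} p⇒q (x ∷ xs) all-p with p x in px
  ... | true rewrite p⇒q x px = and-mono p⇒q xs all-p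

  complete-∷ʳ : ∀ d v c → complete d v ≡ true → complete d (v ∷ʳ c) ≡ true
  complete-∷ʳ d v c = and-mono (λ i → atLeastTwo-mono (copies-∷ʳ i v c)) (allFin d)

  dropLast-∷ʳ : ∀ {A : Set} (v : List A) c → dropLast (v ∷ʳ c) ≡ v
  dropLast-∷ʳ []          c = refl
  dropLast-∷ʳ (x ∷ [])    c = refl
  dropLast-∷ʳ (x ∷ y ∷ v) c = cong (x ∷_) (dropLast-∷ʳ (y ∷ v) c)

  ⟦∧not⟧ : ∀ x y → (y ≡ true → x ≡ true) → ⟦ x ∧ not y ⟧ + ⟦ y ⟧ ≡ ⟦ x ⟧
  ⟦∧not⟧ true  true  _   = refl
  ⟦∧not⟧ true  false _   = refl
  ⟦∧not⟧ false true  y⇒x with () ← y⇒x refl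
  ⟦∧not⟧ false false _   = refl

  -- A word stops exactly at its last letter iff it is complete but its prefix is
  -- not; completeness survives appending letters, so the indicators subtract.
  ⟦stopsExactly⟧ : ∀ d n v c →
                   ⟦ stopsExactly d (suc n) (v ∷ʳ c) ⟧ + ⟦ complete d v ⟧ ≡ ⟦ complete d (v ∷ʳ c) ⟧
  ⟦stopsExactly⟧ d n v c rewrite dropLast-∷ʳ v c =
    ⟦∧not⟧ (complete d (v ∷ʳ c)) (complete d v) (complete-∷ʳ d v c)

  stops : ℕ → ℕ → ℕ
  stops d n = length (filter (λ w → stopsExactly d n w Bool.≟ true) (allSeqs d n))

  length-filter : ∀ {A : Set} (p : A → Bool) xs →
                  + length (filter (λ x → p x Bool.≟ true) xs) ≡ sumᴸ (map (λ x → ⟦ p x ⟧) xs)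
  length-filter p []       = refl
  length-filter p (x ∷ xs) with p x
  ... | true  = trans (ℤₚ.pos-+ 1 _) (cong (_+_ (+ 1)) (length-filter p xs))
  ... | false = trans (length-filter p xs) (sym (ℤₚ.+-identityˡ _))

  stops-suc : ∀ d n → + stops d (suc n) + + d * (χ≥2 ^⋆ d) n ≡ (χ≥2 ^⋆ d) (suc n)
  stops-suc d n = begin
    + stops d (suc n) + + d * (χ≥2 ^⋆ d) n
      ≡⟨ cong₂ _+_ (trans (length-filter _ (allSeqs d (suc n))) (sumᴸ-allSeqs d (suc n) _))
                   (cong (_*_ (+ d)) (sym (trans (wordSum-cong n (⟦complete⟧ d)) (wordSum-weight n _)))) ⟩
    wordSum d (suc n) ⟦stop⟧ + + d * wordSum d n ⟦compl⟧
      ≡⟨ cong₂ _+_ (wordSum-snoc n ⟦stop⟧) (sym (wordSum-*ˡ n (+ d) ⟦compl⟧)) ⟩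
    wordSum d n (λ v → sum (λ c → ⟦stop⟧ (v ∷ʳ c))) + wordSum d n (λ v → + d * ⟦compl⟧ v)
      ≡⟨ sym (wordSum-distrib-+ n _ _) ⟩
    wordSum d n (λ v → sum (λ c → ⟦stop⟧ (v ∷ʳ c)) + + d * ⟦compl⟧ v)
      ≡⟨ wordSum-cong n spread ⟩
    wordSum d n (λ v → sum (λ c → ⟦stop⟧ (v ∷ʳ c) + ⟦compl⟧ v))
      ≡⟨ wordSum-cong n (λ v → sum-cong-≗ (⟦stopsExactly⟧ d n v)) ⟩
    wordSum d n (λ v → sum (λ c → ⟦compl⟧ (v ∷ʳ c)))
      ≡⟨ sym (wordSum-snoc n ⟦compl⟧) ⟩
    wordSum d (suc n) ⟦compl⟧
      ≡⟨ trans (wordSum-cong (suc n) (⟦complete⟧ d)) (wordSum-weight (suc n) _) ⟩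
    (χ≥2 ^⋆ d) (suc n)
      ∎
    where
    open ≡-Reasoning
    ⟦stop⟧ ⟦compl⟧ : List (Fin d) → ℤ
    ⟦stop⟧ w  = ⟦ stopsExactly d (suc n) w ⟧
    ⟦compl⟧ w = ⟦ complete d w ⟧
    spread : ∀ v → sum (λ c → ⟦stop⟧ (v ∷ʳ c)) + + d * ⟦compl⟧ v ≡
                   sum (λ c → ⟦stop⟧ (v ∷ʳ c) + ⟦compl⟧ v)
    spread v = trans (cong (_+_ (sum (λ c → ⟦stop⟧ (v ∷ʳ c)))) (sym (sum-const d (⟦compl⟧ v))))
                     (sym (∑-distrib-+ (λ c → ⟦stop⟧ (v ∷ʳ c)) (λ _ → ⟦compl⟧ v)))

  shift-χ≥2 : shift χ≥2 ≗ χ≥2 +ₛ x· 1ₛ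
  shift-χ≥2 zero          = refl
  shift-χ≥2 (suc zero)    = refl
  shift-χ≥2 (suc (suc n)) = cong (_+_ (+ 1)) (sym (ℤₚ.*-zeroʳ (+ suc (suc n))))

  ⋆-product-shiftAt-χ≥2 : ∀ k (c : Fin (suc k)) →
                          ⋆-product (shiftAt c (λ _ → χ≥2)) ≗ χ≥2 ^⋆ suc k +ₛ x· (χ≥2 ^⋆ k)
  ⋆-product-shiftAt-χ≥2 k fzero n = begin
    (shift χ≥2 ⋆ χ≥2 ^⋆ k) n
      ≡⟨ ⋆-cong shift-χ≥2 (λ _ → refl) n ⟩
    ((χ≥2 +ₛ x· 1ₛ) ⋆ χ≥2 ^⋆ k) n
      ≡⟨ ⋆-distribʳ-+ χ≥2 (x· 1ₛ) (χ≥2 ^⋆ k) n ⟩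
    (χ≥2 ⋆ χ≥2 ^⋆ k) n + (x· 1ₛ ⋆ χ≥2 ^⋆ k) n
      ≡⟨ cong (_+_ ((χ≥2 ⋆ χ≥2 ^⋆ k) n)) (x·1ₛ-⋆ (χ≥2 ^⋆ k) n) ⟩
    (χ≥2 ⋆ χ≥2 ^⋆ k) n + (x· (χ≥2 ^⋆ k)) n
      ∎
    where open ≡-Reasoning
  ⋆-product-shiftAt-χ≥2 (suc k) (fsuc c) n = begin
    (χ≥2 ⋆ ⋆-product (shiftAt c (λ _ → χ≥2))) n
      ≡⟨ ⋆-cong (λ _ → refl) (⋆-product-shiftAt-χ≥2 k c) n ⟩
    (χ≥2 ⋆ (χ≥2 ^⋆ suc k +ₛ x· (χ≥2 ^⋆ k))) n
      ≡⟨ ⋆-distribˡ-+ χ≥2 (χ≥2 ^⋆ suc k) (x· (χ≥2 ^⋆ k)) n ⟩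
    (χ≥2 ⋆ χ≥2 ^⋆ suc k) n + (χ≥2 ⋆ x· (χ≥2 ^⋆ k)) n
      ≡⟨ cong (_+_ ((χ≥2 ⋆ χ≥2 ^⋆ suc k) n)) (⋆-x· χ≥2 (χ≥2 ^⋆ k) n) ⟩
    (χ≥2 ^⋆ suc (suc k)) n + (x· (χ≥2 ^⋆ suc k)) n
      ∎
    where open ≡-Reasoning

  stops-formula : ∀ k n → + stops (suc k) (suc n) ≡ + suc k * (x· (χ≥2 ^⋆ k)) n
  stops-formula k n = +-cancelʳ (+ d * P n) _ _ (begin
    + stops d (suc n) + + d * P n
      ≡⟨ stops-suc d n ⟩
    (χ≥2 ^⋆ d) (suc n)
      ≡⟨ shift-⋆-product {d} (λ _ → χ≥2) n ⟩
    sum {d} (λ c → ⋆-product (shiftAt c (λ _ → χ≥2)) n)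
      ≡⟨ sum-cong-≗ (λ c → ⋆-product-shiftAt-χ≥2 k c n) ⟩
    sum {d} (λ _ → P n + X n)
      ≡⟨ sum-const d (P n + X n) ⟩
    + d * (P n + X n)
      ≡⟨ trans (ℤₚ.*-distribˡ-+ (+ d) (P n) (X n)) (ℤₚ.+-comm (+ d * P n) (+ d * X n)) ⟩
    + d * X n + + d * P n
      ∎)
    where
    open ≡-Reasoning
    d = suc k
    P X : Seq
    P = χ≥2 ^⋆ d
    X = x· (χ≥2 ^⋆ k)

module ClosedForm where

  open BinomialConvolution
  open StoppingCount using (χ≥2; _^⋆_)
  open import Data.Nat using (_∸_)
  open import Data.Nat.Combinatorics using (_C_; nCk+nC[k+1]≡[n+1]C[k+1]; k>n⇒nCk≡0)
  open import Data.Integer using (ℤ; +_; -_; _+_; _-_; _*_)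
  import Data.Integer.Properties as ℤₚ
  open import Data.Integer.Tactic.RingSolver using (solve-∀)
  open import Relation.Binary.PropositionalEquality

  ∑≤-binomial-shift : ∀ k (f : ℕ → ℤ) →
    ∑[ m ≤ k ] (+ (k C m) * f m) ≡ f 0 + ∑[ m ≤ k ] (+ (k C suc m) * f (suc m))
  ∑≤-binomial-shift zero    f =
    trans (ℤₚ.*-identityˡ (f 0)) (sym (ℤₚ.+-identityʳ (f 0)))
  ∑≤-binomial-shift (suc k) f = begin
    ∑[ m ≤ suc k ] (+ (suc k C m) * f m)
      ≡⟨ ∑≤-split-head k (λ m → + (suc k C m) * f m) ⟩
    + 1 * f 0 + ∑[ m ≤ k ] (+ (suc k C suc m) * f (suc m))
      ≡⟨ cong₂ _+_ (ℤₚ.*-identityˡ (f 0)) (sym (ℤₚ.+-identityʳ _)) ⟩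
    f 0 + (∑[ m ≤ k ] (+ (suc k C suc m) * f (suc m)) + + 0)
      ≡⟨ cong (λ c → f 0 + (∑[ m ≤ k ] (+ (suc k C suc m) * f (suc m)) + + c * f (suc (suc k))))
              (sym (k>n⇒nCk≡0 (ℕₚ.n<1+n (suc k)))) ⟩
    f 0 + ∑[ m ≤ suc k ] (+ (suc k C suc m) * f (suc m))
      ∎
    where open ≡-Reasoning

  ∑≤-pascal : ∀ k (f : ℕ → ℤ) →
    ∑[ m ≤ suc k ] (+ (suc k C m) * f m) ≡
    ∑[ m ≤ k ] (+ (k C m) * f m) + ∑[ m ≤ k ] (+ (k C m) * f (suc m))
  ∑≤-pascal k f = begin
    ∑[ m ≤ suc k ] (+ (suc k C m) * f m)
      ≡⟨ ∑≤-split-head k (λ m → + (suc k C m) * f m) ⟩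
    + 1 * f 0 + ∑[ m ≤ k ] (+ (suc k C suc m) * f (suc m))
      ≡⟨ cong₂ _+_ (ℤₚ.*-identityˡ (f 0)) (∑≤-cong k (λ m _ → pascal m)) ⟩
    f 0 + ∑[ m ≤ k ] (+ (k C suc m) * f (suc m) + + (k C m) * f (suc m))
      ≡⟨ cong (_+_ (f 0)) (∑≤-distrib-+ k _ _) ⟩
    f 0 + (∑[ m ≤ k ] (+ (k C suc m) * f (suc m)) + ∑[ m ≤ k ] (+ (k C m) * f (suc m)))
      ≡⟨ sym (ℤₚ.+-assoc (f 0) _ _) ⟩
    f 0 + ∑[ m ≤ k ] (+ (k C suc m) * f (suc m)) + ∑[ m ≤ k ] (+ (k C m) * f (suc m))
      ≡⟨ cong (_+ ∑[ m ≤ k ] (+ (k C m) * f (suc m))) (sym (∑≤-binomial-shift k f)) ⟩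
    ∑[ m ≤ k ] (+ (k C m) * f m) + ∑[ m ≤ k ] (+ (k C m) * f (suc m))
      ∎
    where
    open ≡-Reasoning
    pascal : ∀ m → + (suc k C suc m) * f (suc m) ≡ + (k C suc m) * f (suc m) + + (k C m) * f (suc m)
    pascal m = begin
      + (suc k C suc m) * f (suc m)
        ≡⟨ cong (λ c → + c * f (suc m)) (sym (nCk+nC[k+1]≡[n+1]C[k+1] k m)) ⟩
      + (k C m ℕ.+ k C suc m) * f (suc m)
        ≡⟨ cong (_* f (suc m)) (trans (ℤₚ.pos-+ (k C m) (k C suc m))
                                      (ℤₚ.+-comm (+ (k C m)) (+ (k C suc m)))) ⟩
      (+ (k C suc m) + + (k C m)) * f (suc m)
        ≡⟨ ℤₚ.*-distribʳ-+ (f (suc m)) (+ (k C suc m)) (+ (k C m)) ⟩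
      + (k C suc m) * f (suc m) + + (k C m) * f (suc m)
        ∎

  -- Ψ m r is the generating function (1 + x)ᵐ eʳˣ, and Φ k is the binomial expansion
  -- (eˣ - 1 - x)ᵏ = ∑ₘ C(k,m) (-1)ᵐ (1 + x)ᵐ e⁽ᵏ⁻ᵐ⁾ˣ of the generating function of χ≥2 ^⋆ k.
  Ψ : ℕ → ℕ → Seq
  Ψ m r n = ∑[ j ≤ m ] (+ (m C j) * powExp j r n)

  Φ : ℕ → Seq
  Φ k n = ∑[ m ≤ k ] (+ (k C m) * (sign m * Ψ m (k ∸ m) n))

  eˣ⋆Ψ : ∀ m r → eˣ ⋆ Ψ m r ≗ Ψ m (suc r)
  eˣ⋆Ψ m r n =
    trans (⋆-∑≤ m eˣ (λ j → + (m C j) ·ₛ powExp j r) n)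
          (∑≤-cong m (λ j _ → trans (⋆-·ₛ (+ (m C j)) eˣ (powExp j r) n)
                                    (cong (_*_ (+ (m C j))) (eˣ⋆powExp j r n))))

  x·Ψ : ∀ m r → x· Ψ m r ≗ (λ n → ∑[ j ≤ m ] (+ (m C j) * powExp (suc j) r n))
  x·Ψ m r = x·-∑≤ m (λ j → + (m C j)) (λ j → powExp j r)

  Ψ-suc : ∀ m r → Ψ (suc m) r ≗ Ψ m r +ₛ x· Ψ m r
  Ψ-suc m r n =
    trans (∑≤-pascal m (λ j → powExp j r n)) (cong (_+_ (Ψ m r n)) (sym (x·Ψ m r n)))

  χ≥2-decomposition : χ≥2 ≗ eˣ -ₛ 1ₛ -ₛ x· 1ₛ
  χ≥2-decomposition zero          = refl
  χ≥2-decomposition (suc zero)    = refl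
  χ≥2-decomposition (suc (suc n)) = cong (λ t → + 1 - + 0 - t) (sym (ℤₚ.*-zeroʳ (+ suc (suc n))))

  χ≥2-⋆ : ∀ a → χ≥2 ⋆ a ≗ eˣ ⋆ a -ₛ a -ₛ x· a
  χ≥2-⋆ a n = begin
    (χ≥2 ⋆ a) n
      ≡⟨ ⋆-cong χ≥2-decomposition (λ _ → refl) n ⟩
    ((eˣ -ₛ 1ₛ -ₛ x· 1ₛ) ⋆ a) n
      ≡⟨ ⋆-distribʳ-- (eˣ -ₛ 1ₛ) (x· 1ₛ) a n ⟩
    ((eˣ -ₛ 1ₛ) ⋆ a) n - (x· 1ₛ ⋆ a) n
      ≡⟨ cong₂ _-_ (⋆-distribʳ-- eˣ 1ₛ a n) (x·1ₛ-⋆ a n) ⟩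
    (eˣ ⋆ a) n - (1ₛ ⋆ a) n - (x· a) n
      ≡⟨ cong (λ t → (eˣ ⋆ a) n - t - (x· a) n) (⋆-identityˡ a n) ⟩
    (eˣ ⋆ a) n - a n - (x· a) n
      ∎
    where open ≡-Reasoning

  χ≥2-⋆-Ψ : ∀ m r → χ≥2 ⋆ Ψ m r ≗ Ψ m (suc r) -ₛ Ψ (suc m) r
  χ≥2-⋆-Ψ m r n = begin
    (χ≥2 ⋆ Ψ m r) n
      ≡⟨ χ≥2-⋆ (Ψ m r) n ⟩
    (eˣ ⋆ Ψ m r) n - Ψ m r n - (x· Ψ m r) n
      ≡⟨ cong (λ t → t - Ψ m r n - (x· Ψ m r) n) (eˣ⋆Ψ m r n) ⟩
    Ψ m (suc r) n - Ψ m r n - (x· Ψ m r) n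
      ≡⟨ sub-sub (Ψ m (suc r) n) (Ψ m r n) ((x· Ψ m r) n) ⟩
    Ψ m (suc r) n - (Ψ m r n + (x· Ψ m r) n)
      ≡⟨ cong (_-_ (Ψ m (suc r) n)) (sym (Ψ-suc m r n)) ⟩
    Ψ m (suc r) n - Ψ (suc m) r n
      ∎
    where
    open ≡-Reasoning
    sub-sub : ∀ x y z → x - y - z ≡ x - (y + z)
    sub-sub = solve-∀

  χ≥2-⋆-Φ : ∀ k → χ≥2 ⋆ Φ k ≗ Φ (suc k)
  χ≥2-⋆-Φ k n = begin
    (χ≥2 ⋆ Φ k) n
      ≡⟨ ⋆-∑≤ k χ≥2 (λ m → c m ·ₛ sign m ·ₛ Ψ m (k ∸ m)) n ⟩
    ∑[ m ≤ k ] (χ≥2 ⋆ (c m ·ₛ sign m ·ₛ Ψ m (k ∸ m))) n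
      ≡⟨ ∑≤-cong k (λ m m≤k → split m m≤k) ⟩
    ∑[ m ≤ k ] (c m * rise m + c m * fall m)
      ≡⟨ ∑≤-distrib-+ k (λ m → c m * rise m) (λ m → c m * fall m) ⟩
    ∑[ m ≤ k ] (c m * rise m) + ∑[ m ≤ k ] (c m * fall m)
      ≡⟨ sym (∑≤-pascal k rise) ⟩
    Φ (suc k) n
      ∎
    where
    open ≡-Reasoning
    c : ℕ → ℤ
    c m = + (k C m)
    rise fall : ℕ → ℤ
    rise m = sign m * Ψ m (suc k ∸ m) n
    fall m = rise (suc m)
    split-sign : ∀ c s x y → c * (s * (x - y)) ≡ c * (s * x) + c * (- s * y)
    split-sign = solve-∀
    split : ∀ m → m ℕ.≤ k → (χ≥2 ⋆ (c m ·ₛ sign m ·ₛ Ψ m (k ∸ m))) n ≡ c m * rise m + c m * fall m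
    split m m≤k = begin
      (χ≥2 ⋆ (c m ·ₛ sign m ·ₛ Ψ m (k ∸ m))) n
        ≡⟨ trans (⋆-·ₛ (c m) χ≥2 _ n) (cong (c m *_) (⋆-·ₛ (sign m) χ≥2 _ n)) ⟩
      c m * (sign m * (χ≥2 ⋆ Ψ m (k ∸ m)) n)
        ≡⟨ cong (λ t → c m * (sign m * t)) (χ≥2-⋆-Ψ m (k ∸ m) n) ⟩
      c m * (sign m * (Ψ m (suc (k ∸ m)) n - Ψ (suc m) (k ∸ m) n))
        ≡⟨ split-sign (c m) (sign m) _ _ ⟩
      c m * (sign m * Ψ m (suc (k ∸ m)) n) + c m * fall m
        ≡⟨ cong (λ r → c m * (sign m * Ψ m r n) + c m * fall m) (sym (ℕₚ.+-∸-assoc 1 m≤k)) ⟩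
      c m * rise m + c m * fall m
        ∎

  χ≥2^⋆≗Φ : ∀ k → χ≥2 ^⋆ k ≗ Φ k
  χ≥2^⋆≗Φ zero    zero    = refl
  χ≥2^⋆≗Φ zero    (suc n) = refl
  χ≥2^⋆≗Φ (suc k) n       = trans (⋆-cong (λ _ → refl) (χ≥2^⋆≗Φ k) n) (χ≥2-⋆-Φ k n)

  coefficient : ℕ → ℕ → ℕ → ℤ
  coefficient k m j = sign m * + ((k C m) ℕ.* (m C j))

  x·x·Φ : ∀ k n →
          (x· x· Φ k) n ≡ ∑[ m ≤ k ] ∑[ j ≤ m ] (coefficient k m j * powExp (2 ℕ.+ j) (k ∸ m) n)
  x·x·Φ k n = begin
    (x· x· Φ k) n
      ≡⟨ x·-cong (x·-∑≤ k c a) n ⟩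
    (x· (λ n → ∑[ m ≤ k ] (c m * (x· a m) n))) n
      ≡⟨ x·-∑≤ k c (λ m → x· a m) n ⟩
    ∑[ m ≤ k ] (c m * (x· x· a m) n)
      ≡⟨ ∑≤-cong k (λ m _ → cong (c m *_) (trans (x·-cong (x·-·ₛ (sign m) (Ψ m (k ∸ m))) n)
                                                  (x·-·ₛ (sign m) (x· Ψ m (k ∸ m)) n))) ⟩
    ∑[ m ≤ k ] (c m * (sign m * (x· x· Ψ m (k ∸ m)) n))
      ≡⟨ ∑≤-cong k (λ m _ → cong (λ t → c m * (sign m * t)) (x·x·Ψ m (k ∸ m))) ⟩
    ∑[ m ≤ k ] (c m * (sign m * ∑[ j ≤ m ] (+ (m C j) * powExp (2 ℕ.+ j) (k ∸ m) n)))
      ≡⟨ ∑≤-cong k (λ m _ → distribute m) ⟩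
    ∑[ m ≤ k ] ∑[ j ≤ m ] (coefficient k m j * powExp (2 ℕ.+ j) (k ∸ m) n)
      ∎
    where
    open ≡-Reasoning
    c : ℕ → ℤ
    c m = + (k C m)
    a : ℕ → Seq
    a m = sign m ·ₛ Ψ m (k ∸ m)
    x·x·Ψ : ∀ m r → (x· x· Ψ m r) n ≡ ∑[ j ≤ m ] (+ (m C j) * powExp (2 ℕ.+ j) r n)
    x·x·Ψ m r = trans (x·-cong (x·Ψ m r) n) (x·-∑≤ m (λ j → + (m C j)) (λ j → powExp (suc j) r) n)
    regroup : ∀ c s b p → c * (s * (b * p)) ≡ s * (c * b) * p
    regroup = solve-∀
    distribute : ∀ m → c m * (sign m * ∑[ j ≤ m ] (+ (m C j) * powExp (2 ℕ.+ j) (k ∸ m) n)) ≡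
                       ∑[ j ≤ m ] (coefficient k m j * powExp (2 ℕ.+ j) (k ∸ m) n)
    distribute m = begin
      c m * (sign m * ∑[ j ≤ m ] (+ (m C j) * p j))
        ≡⟨ cong (c m *_) (*-distribˡ-∑≤ m (sign m) _) ⟩
      c m * ∑[ j ≤ m ] (sign m * (+ (m C j) * p j))
        ≡⟨ *-distribˡ-∑≤ m (c m) _ ⟩
      ∑[ j ≤ m ] (c m * (sign m * (+ (m C j) * p j)))
        ≡⟨ ∑≤-cong m (λ j _ → trans (regroup (c m) (sign m) (+ (m C j)) (p j))
                                    (cong (λ t → sign m * t * p j) (sym (ℤₚ.pos-* (k C m) (m C j))))) ⟩
      ∑[ j ≤ m ] (coefficient k m j * p j)
        ∎
      where
      p : ℕ → ℤ
      p j = powExp (2 ℕ.+ j) (k ∸ m) n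

module Absorption where

  open import Data.Nat using (_+_; _*_)
  open import Data.Nat.Combinatorics using (_C_; nCk+nC[k+1]≡[n+1]C[k+1]; nC1≡n)
  open import Data.Nat.Tactic.RingSolver using (solve-∀)
  open import Relation.Binary.PropositionalEquality

  [k+1]*[n+1]C[k+1]≡[n+1]*nCk : ∀ n k → suc k * (suc n C suc k) ≡ suc n * (n C k)
  [k+1]*[n+1]C[k+1]≡[n+1]*nCk zero    zero    = refl
  [k+1]*[n+1]C[k+1]≡[n+1]*nCk zero    (suc j) = ℕₚ.*-zeroʳ (suc (suc j))
  [k+1]*[n+1]C[k+1]≡[n+1]*nCk (suc n) zero    =
    trans (ℕₚ.+-identityʳ _) (trans (nC1≡n (suc (suc n))) (sym (ℕₚ.*-identityʳ _)))
  [k+1]*[n+1]C[k+1]≡[n+1]*nCk (suc n) (suc j) = begin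
    suc (suc j) * (suc (suc n) C suc (suc j))
      ≡⟨ cong (suc (suc j) *_) (sym (nCk+nC[k+1]≡[n+1]C[k+1] (suc n) (suc j))) ⟩
    suc (suc j) * (a + b)
      ≡⟨ expand j a b ⟩
    suc j * a + a + suc (suc j) * b
      ≡⟨ cong₂ (λ u v → u + a + v) ([k+1]*[n+1]C[k+1]≡[n+1]*nCk n j)
                                   ([k+1]*[n+1]C[k+1]≡[n+1]*nCk n (suc j)) ⟩
    suc n * (n C j) + a + suc n * (n C suc j)
      ≡⟨ cong (λ t → suc n * (n C j) + t + suc n * (n C suc j)) (sym (nCk+nC[k+1]≡[n+1]C[k+1] n j)) ⟩
    suc n * (n C j) + (n C j + n C suc j) + suc n * (n C suc j)
      ≡⟨ collect n (n C j) (n C suc j) ⟩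
    suc (suc n) * (n C j + n C suc j)
      ≡⟨ cong (suc (suc n) *_) (nCk+nC[k+1]≡[n+1]C[k+1] n j) ⟩
    suc (suc n) * a
      ∎
    where
    open ≡-Reasoning
    a = suc n C suc j
    b = suc n C suc (suc j)
    expand : ∀ j a b → suc (suc j) * (a + b) ≡ suc j * a + a + suc (suc j) * b
    expand = solve-∀
    collect : ∀ n c e → suc n * c + (c + e) + suc n * e ≡ suc (suc n) * (c + e)
    collect = solve-∀


-- With d = r + s, horner-identity says that s^(i+1) ∑_{n<M} C(n,i) r^(n-i) d^(M-1-n)
-- is the upper tail ∑_{l>i} C(M,l) sˡ r^(M-l) of the binomial expansion of dᴹ: if
-- more than i of M trials succeed, the (i+1)-st success happens at some trial n+1.
module NegativeBinomialTail (r s : ℕ) where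

  open import Data.Nat using (_+_; _*_; _^_; _∸_; _≤_)
  open import Data.Nat.Combinatorics using (_C_; nCk+nC[k+1]≡[n+1]C[k+1]; k>n⇒nCk≡0)
  open import Data.Nat.Tactic.RingSolver using (solve-∀)
  open import Data.Sum using (inj₁; inj₂)
  open import Relation.Binary.PropositionalEquality
  open RangeSum ℕₚ.+-*-commutativeSemiring
  open Absorption using ([k+1]*[n+1]C[k+1]≡[n+1]*nCk)

  d : ℕ
  d = r + s

  binomialTerm : ℕ → ℕ → ℕ
  binomialTerm M l = (M C l) * s ^ l * r ^ (M ∸ l)

  lowerTail : ℕ → ℕ → ℕ
  lowerTail i M = ∑[ l ≤ i ] binomialTerm M l

  -- Horner form of ∑_{n<M} C(n,i) r^(n-i) d^(M-1-n).
  horner : ℕ → ℕ → ℕ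
  horner i zero    = 0
  horner i (suc M) = horner i M * d + (M C i) * r ^ (M ∸ i)

  lowerTail-zero : ∀ i → lowerTail i 0 ≡ 1
  lowerTail-zero zero    = refl
  lowerTail-zero (suc i) = cong (_+ 0) (lowerTail-zero i)

  -- For i ≥ M both exponents are truncated to 0, but then C(M, i+1) = 0.
  C*^∸-suc : ∀ M i → (M C suc i) * r ^ (M ∸ i) ≡ (M C suc i) * (r * r ^ (M ∸ suc i))
  C*^∸-suc M i with ℕₚ.<-≤-connex i M
  ... | inj₁ i<M = cong (λ e → (M C suc i) * r ^ e) (ℕₚ.+-∸-assoc 1 i<M)
  ... | inj₂ M≤i rewrite k>n⇒nCk≡0 (s≤s M≤i) = refl

  lowerTail-suc : ∀ i M → d * lowerTail i M ≡ s ^ suc i * ((M C i) * r ^ (M ∸ i)) + lowerTail i (suc M)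
  lowerTail-suc zero    M = rearrange r s (r ^ M)
    where
    rearrange : ∀ r s x → (r + s) * (1 * 1 * x) ≡ s * 1 * (1 * x) + 1 * 1 * (r * x)
    rearrange = solve-∀
  lowerTail-suc (suc i) M = begin
    d * (lowerTail i M + B₁ * S * Q)
      ≡⟨ ℕₚ.*-distribˡ-+ d (lowerTail i M) (B₁ * S * Q) ⟩
    d * lowerTail i M + d * (B₁ * S * Q)
      ≡⟨ cong (_+ d * (B₁ * S * Q)) (lowerTail-suc i M) ⟩
    S * (B₀ * P) + L′ + d * (B₁ * S * Q)
      ≡⟨ regroup r s S B₀ B₁ P Q L′ ⟩
    s * S * (B₁ * Q) + (L′ + (B₀ * S * P + S * (B₁ * (r * Q))))
      ≡⟨ cong (λ t → s * S * (B₁ * Q) + (L′ + (B₀ * S * P + S * t))) (sym (C*^∸-suc M i)) ⟩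
    s * S * (B₁ * Q) + (L′ + (B₀ * S * P + S * (B₁ * P)))
      ≡⟨ cong (λ t → s * S * (B₁ * Q) + (L′ + t)) (factor B₀ B₁ S P) ⟩
    s * S * (B₁ * Q) + (L′ + (B₀ + B₁) * S * P)
      ≡⟨ cong (λ c → s * S * (B₁ * Q) + (L′ + c * S * P)) (nCk+nC[k+1]≡[n+1]C[k+1] M i) ⟩
    s * S * (B₁ * Q) + lowerTail (suc i) (suc M)
      ∎
    where
    open ≡-Reasoning
    S  = s ^ suc i
    B₀ = M C i
    B₁ = M C suc i
    P  = r ^ (M ∸ i)
    Q  = r ^ (M ∸ suc i)
    L′ = lowerTail i (suc M)
    regroup : ∀ r s S B₀ B₁ P Q L → S * (B₀ * P) + L + (r + s) * (B₁ * S * Q) ≡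
                                    s * S * (B₁ * Q) + (L + (B₀ * S * P + S * (B₁ * (r * Q))))
    regroup = solve-∀
    factor : ∀ B₀ B₁ S P → B₀ * S * P + S * (B₁ * P) ≡ (B₀ + B₁) * S * P
    factor = solve-∀

  horner-identity : ∀ i M → s ^ suc i * horner i M + lowerTail i M ≡ d ^ M
  horner-identity i zero    = trans (cong₂ _+_ (ℕₚ.*-zeroʳ (s ^ suc i)) (lowerTail-zero i)) refl
  horner-identity i (suc M) = begin
    s ^ suc i * (horner i M * d + G) + lowerTail i (suc M)
      ≡⟨ regroup (s ^ suc i) (horner i M) d G (lowerTail i (suc M)) ⟩
    d * (s ^ suc i * horner i M) + (s ^ suc i * G + lowerTail i (suc M))
      ≡⟨ cong (d * (s ^ suc i * horner i M) +_) (sym (lowerTail-suc i M)) ⟩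
    d * (s ^ suc i * horner i M) + d * lowerTail i M
      ≡⟨ sym (ℕₚ.*-distribˡ-+ d _ _) ⟩
    d * (s ^ suc i * horner i M + lowerTail i M)
      ≡⟨ cong (d *_) (horner-identity i M) ⟩
    d ^ suc M
      ∎
    where
    open ≡-Reasoning
    G = (M C i) * r ^ (M ∸ i)
    regroup : ∀ A T d G L → A * (T * d + G) + L ≡ d * (A * T) + (A * G + L)
    regroup = solve-∀

  lowerTail≤ : ∀ i M → lowerTail i M ≤ d ^ M
  lowerTail≤ i M = subst (lowerTail i M ≤_) (horner-identity i M) (ℕₚ.m≤n+m _ _)

  binomialTerm≤ : ∀ M l → binomialTerm M l ≤ d ^ M
  binomialTerm≤ M zero    = lowerTail≤ 0 M
  binomialTerm≤ M (suc l) = ℕₚ.≤-trans (ℕₚ.m≤n+m _ (lowerTail l M)) (lowerTail≤ (suc l) M)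

  s*suc-*-binomialTerm : ∀ M l → s * (suc M * binomialTerm M l) ≡ suc l * binomialTerm (suc M) (suc l)
  s*suc-*-binomialTerm M l = begin
    s * (suc M * ((M C l) * s ^ l * R))
      ≡⟨ regroup s (suc M) (M C l) (s ^ l) R ⟩
    suc M * (M C l) * (s * s ^ l) * R
      ≡⟨ cong (λ t → t * (s * s ^ l) * R) (sym ([k+1]*[n+1]C[k+1]≡[n+1]*nCk M l)) ⟩
    suc l * (suc M C suc l) * (s * s ^ l) * R
      ≡⟨ reassoc (suc l) (suc M C suc l) (s * s ^ l) R ⟩
    suc l * ((suc M C suc l) * (s * s ^ l) * R)
      ∎
    where
    open ≡-Reasoning
    R = r ^ (M ∸ l)
    regroup : ∀ s m c S R → s * (m * (c * S * R)) ≡ m * c * (s * S) * R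
    regroup = solve-∀
    reassoc : ∀ l c S R → l * c * S * R ≡ l * (c * S * R)
    reassoc = solve-∀

  suc-*-binomialTerm≤ : .{{NonZero s}} → ∀ M l → suc M * binomialTerm M l ≤ suc l * d ^ suc M
  suc-*-binomialTerm≤ M l = begin
    suc M * binomialTerm M l                 ≤⟨ ℕₚ.m≤n*m _ s ⟩
    s * (suc M * binomialTerm M l)           ≡⟨ s*suc-*-binomialTerm M l ⟩
    suc l * binomialTerm (suc M) (suc l)     ≤⟨ ℕₚ.*-monoʳ-≤ (suc l) (binomialTerm≤ (suc M) (suc l)) ⟩
    suc l * d ^ suc M                        ∎
    where open ℕₚ.≤-Reasoning

  tailConstant : ℕ → ℕ
  tailConstant i = ∑[ l ≤ i ] suc l

  suc-*-lowerTail≤ : .{{NonZero s}} → ∀ i M → suc M * lowerTail i M ≤ tailConstant i * d ^ suc M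
  suc-*-lowerTail≤ zero    M = suc-*-binomialTerm≤ M 0
  suc-*-lowerTail≤ (suc i) M = begin
    suc M * (lowerTail i M + binomialTerm M (suc i))
      ≡⟨ ℕₚ.*-distribˡ-+ (suc M) (lowerTail i M) (binomialTerm M (suc i)) ⟩
    suc M * lowerTail i M + suc M * binomialTerm M (suc i)
      ≤⟨ ℕₚ.+-mono-≤ (suc-*-lowerTail≤ i M) (suc-*-binomialTerm≤ M (suc i)) ⟩
    tailConstant i * d ^ suc M + suc (suc i) * d ^ suc M
      ≡⟨ sym (ℕₚ.*-distribʳ-+ (d ^ suc M) (tailConstant i) _) ⟩
    tailConstant (suc i) * d ^ suc M
      ∎
    where open ℕₚ.≤-Reasoning

module Fractions where

  open import Data.Integer as ℤ using (ℤ; +_)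
  import Data.Integer.Properties as ℤₚ
  open import Data.Integer.Tactic.RingSolver using (solve-∀)
  open import Data.Rational using (ℚ; _/_; _+_; _*_; _≤_; _<_; ∣_∣; toℚᵘ)
  import Data.Rational.Properties as ℚₚ
  import Data.Rational.Unnormalised as ℚᵘ
  import Data.Rational.Unnormalised.Properties as ℚᵘₚ
  open import Relation.Binary.PropositionalEquality

  private
    toℚᵘ-/ : ∀ p a .{{_ : NonZero a}} → toℚᵘ (p / a) ℚᵘ.≃ (p ℚᵘ./ a)
    toℚᵘ-/ p (suc a) = ℚₚ.toℚᵘ-fromℚᵘ (ℚᵘ.mkℚᵘ p a)

  -- Fractions are compared by cross-multiplication, so that no product of
  -- denominators (and no proof of its non-vanishing) ever has to be written.
  /-≡-/ : ∀ p q a b .{{_ : NonZero a}} .{{_ : NonZero b}} → p ℤ.* + b ≡ q ℤ.* + a → p / a ≡ q / b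
  /-≡-/ p q a@(suc _) b@(suc _) eq = ℚₚ.toℚᵘ-injective
    (ℚᵘₚ.≃-trans (toℚᵘ-/ p a) (ℚᵘₚ.≃-trans (ℚᵘ.*≡* eq) (ℚᵘₚ.≃-sym (toℚᵘ-/ q b))))

  /-≤-/ : ∀ p q a b .{{_ : NonZero a}} .{{_ : NonZero b}} → p ℤ.* + b ℤ.≤ q ℤ.* + a → p / a ≤ q / b
  /-≤-/ p q a@(suc _) b@(suc _) le = ℚₚ.toℚᵘ-cancel-≤
    (ℚᵘₚ.≤-respˡ-≃ (ℚᵘₚ.≃-sym (toℚᵘ-/ p a))
      (ℚᵘₚ.≤-respʳ-≃ (ℚᵘₚ.≃-sym (toℚᵘ-/ q b)) (ℚᵘ.*≤* le)))

  /-<-/ : ∀ p q a b .{{_ : NonZero a}} .{{_ : NonZero b}} → p ℤ.* + b ℤ.< q ℤ.* + a → p / a < q / b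
  /-<-/ p q a@(suc _) b@(suc _) lt = ℚₚ.toℚᵘ-cancel-<
    (ℚᵘₚ.<-respˡ-≃ (ℚᵘₚ.≃-sym (toℚᵘ-/ p a))
      (ℚᵘₚ.<-respʳ-≃ (ℚᵘₚ.≃-sym (toℚᵘ-/ q b)) (ℚᵘ.*<* lt)))

  /-+-/ : ∀ p q r a b c .{{_ : NonZero a}} .{{_ : NonZero b}} .{{_ : NonZero c}} →
          (p ℤ.* + b ℤ.+ q ℤ.* + a) ℤ.* + c ≡ r ℤ.* + (a ℕ.* b) → p / a + q / b ≡ r / c
  /-+-/ p q r a@(suc _) b@(suc _) c@(suc _) eq = ℚₚ.toℚᵘ-injective
    (ℚᵘₚ.≃-trans (ℚₚ.toℚᵘ-homo-+ (p / a) (q / b))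
      (ℚᵘₚ.≃-trans (ℚᵘₚ.+-cong (toℚᵘ-/ p a) (toℚᵘ-/ q b))
        (ℚᵘₚ.≃-trans (ℚᵘ.*≡* eq) (ℚᵘₚ.≃-sym (toℚᵘ-/ r c)))))

  /-*-/ : ∀ p q r a b c .{{_ : NonZero a}} .{{_ : NonZero b}} .{{_ : NonZero c}} →
          p ℤ.* q ℤ.* + c ≡ r ℤ.* + (a ℕ.* b) → (p / a) * (q / b) ≡ r / c
  /-*-/ p q r a@(suc _) b@(suc _) c@(suc _) eq = ℚₚ.toℚᵘ-injective
    (ℚᵘₚ.≃-trans (ℚₚ.toℚᵘ-homo-* (p / a) (q / b))
      (ℚᵘₚ.≃-trans (ℚᵘₚ.*-cong (toℚᵘ-/ p a) (toℚᵘ-/ q b))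
        (ℚᵘₚ.≃-trans (ℚᵘ.*≡* eq) (ℚᵘₚ.≃-sym (toℚᵘ-/ r c)))))

  ∣/∣ : ∀ p a .{{_ : NonZero a}} → ∣ p / a ∣ ≡ + ℤ.∣ p ∣ / a
  ∣/∣ p a@(suc _) = ℚₚ.toℚᵘ-injective (ℚᵘₚ.≃-trans (ℚₚ.toℚᵘ-homo-∣-∣ (p / a))
    (ℚᵘₚ.≃-trans (ℚᵘₚ.∣-∣-cong (toℚᵘ-/ p a)) (ℚᵘₚ.≃-sym (toℚᵘ-/ _ a))))

  +-/ : ∀ p q a .{{_ : NonZero a}} → (p ℤ.+ q) / a ≡ p / a + q / a
  +-/ p q a = sym (/-+-/ p q (p ℤ.+ q) a a a
    (trans (regroup p q (+ a)) (cong ((p ℤ.+ q) ℤ.*_) (sym (ℤₚ.pos-* a a)))))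
    where
    regroup : ∀ p q a → (p ℤ.* a ℤ.+ q ℤ.* a) ℤ.* a ≡ (p ℤ.+ q) ℤ.* (a ℤ.* a)
    regroup = solve-∀

  *-/ : ∀ p q a .{{_ : NonZero a}} → (p ℤ.* q) / a ≡ (p / 1) * (q / a)
  *-/ p q a = sym (/-*-/ p q (p ℤ.* q) 1 a a (cong (λ t → p ℤ.* q ℤ.* + t) (sym (ℕₚ.*-identityˡ a))))

  ℕ/-≤-ℕ/ : ∀ p q a b .{{_ : NonZero a}} .{{_ : NonZero b}} → p ℕ.* b ℕ.≤ q ℕ.* a → + p / a ≤ + q / b
  ℕ/-≤-ℕ/ p q a b le =
    /-≤-/ (+ p) (+ q) a b (subst₂ ℤ._≤_ (ℤₚ.pos-* p b) (ℤₚ.pos-* q a) (ℤ.+≤+ le))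

  ℕ/-+-ℕ/ : ∀ p q r a b c .{{_ : NonZero a}} .{{_ : NonZero b}} .{{_ : NonZero c}} →
            (p ℕ.* b ℕ.+ q ℕ.* a) ℕ.* c ≡ r ℕ.* (a ℕ.* b) → + p / a + + q / b ≡ + r / c
  ℕ/-+-ℕ/ p q r a b c eq = /-+-/ (+ p) (+ q) (+ r) a b c (begin
    (+ p ℤ.* + b ℤ.+ + q ℤ.* + a) ℤ.* + c   ≡⟨ cong (ℤ._* + c) (sym (trans (ℤₚ.pos-+ (p ℕ.* b) _)
                                                 (cong₂ ℤ._+_ (ℤₚ.pos-* p b) (ℤₚ.pos-* q a)))) ⟩
    + (p ℕ.* b ℕ.+ q ℕ.* a) ℤ.* + c         ≡⟨ sym (ℤₚ.pos-* (p ℕ.* b ℕ.+ q ℕ.* a) c) ⟩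
    + ((p ℕ.* b ℕ.+ q ℕ.* a) ℕ.* c)         ≡⟨ cong +_ eq ⟩
    + (r ℕ.* (a ℕ.* b))                     ≡⟨ ℤₚ.pos-* r _ ⟩
    + r ℤ.* + (a ℕ.* b)                     ∎)
    where open ≡-Reasoning

  ℕ/-*-ℕ/ : ∀ p q r a b c .{{_ : NonZero a}} .{{_ : NonZero b}} .{{_ : NonZero c}} →
            p ℕ.* q ℕ.* c ≡ r ℕ.* (a ℕ.* b) → (+ p / a) * (+ q / b) ≡ + r / c
  ℕ/-*-ℕ/ p q r a b c eq = /-*-/ (+ p) (+ q) (+ r) a b c (begin
    + p ℤ.* + q ℤ.* + c       ≡⟨ cong (ℤ._* + c) (sym (ℤₚ.pos-* p q)) ⟩
    + (p ℕ.* q) ℤ.* + c       ≡⟨ sym (ℤₚ.pos-* (p ℕ.* q) c) ⟩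
    + (p ℕ.* q ℕ.* c)         ≡⟨ cong +_ eq ⟩
    + (r ℕ.* (a ℕ.* b))       ≡⟨ ℤₚ.pos-* r _ ⟩
    + r ℤ.* + (a ℕ.* b)       ∎)
    where open ≡-Reasoning

module RateOfConvergence where

  open Fractions
  open import Algebra.Bundles using (CommutativeRing)
  open import Data.Nat using (_⊔_)
  open import Data.Integer as ℤ using (ℤ; +_; +<+; -[1+_])
  import Data.Integer.Properties as ℤₚ
  open import Data.Rational
    using (ℚ; mkℚ; 0ℚ; _/_; _+_; _-_; _*_; _≤_; _<_; ∣_∣; ↧ₙ_; *<*; positive; NonNegative)
  import Data.Rational.Properties as ℚₚ
  open import Data.Rational.Solver using (module +-*-Solver)
  open import Data.Product using (Σ; ∃; _,_)
  open import Relation.Binary.PropositionalEquality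
  open import Data.Nat.Tactic.RingSolver using (solve-∀)
  open RangeSum (CommutativeRing.commutativeSemiring ℚₚ.+-*-commutativeRing) public

  ⌜_⌝ : ℕ → ℚ
  ⌜ n ⌝ = + n / 1

  ⌜⌝-nonNeg : ∀ n → NonNegative ⌜ n ⌝
  ⌜⌝-nonNeg n = ℚₚ.normalize-nonNeg n 1

  ⌜⌝-mono-≤ : ∀ {m n} → m ℕ.≤ n → ⌜ m ⌝ ≤ ⌜ n ⌝
  ⌜⌝-mono-≤ {m} {n} m≤n = ℕ/-≤-ℕ/ m n 1 1 (ℕₚ.*-monoˡ-≤ 1 m≤n)

  ⌜⌝-+ : ∀ m n → ⌜ m ⌝ + ⌜ n ⌝ ≡ ⌜ m ℕ.+ n ⌝
  ⌜⌝-+ m n = ℕ/-+-ℕ/ m n (m ℕ.+ n) 1 1 1 (drop-1s m n)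
    where
    drop-1s : ∀ m n → (m ℕ.* 1 ℕ.+ n ℕ.* 1) ℕ.* 1 ≡ (m ℕ.+ n) ℕ.* 1
    drop-1s = solve-∀

  -- K is a natural number so that the Archimedean step only compares naturals.
  Converges1/N : (ℕ → ℚ) → ℚ → Set
  Converges1/N a L = Σ ℕ λ K → Σ ℕ λ I → ∀ N → I ℕ.≤ N → ∣ a N - L ∣ * ⌜ N ⌝ ≤ ⌜ K ⌝

  archimedean : ∀ K ε → 0ℚ < ε → ⌜ K ⌝ < ε * ⌜ suc K ℕ.* ↧ₙ ε ⌝
  archimedean K ε@(mkℚ (+ suc p) q _) _ = begin-strict
    ⌜ K ⌝
      <⟨ /-<-/ (+ K) (+ suc p ℤ.* + N) 1 (suc q) (subst₂ ℤ._<_ (ℤₚ.pos-* K _) pos-** (+<+ K*q<p*N)) ⟩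
    (+ suc p ℤ.* + N) / suc q
      ≡⟨ sym (/-*-/ (+ suc p) (+ N) (+ suc p ℤ.* + N) (suc q) 1 (suc q)
                    (cong (λ t → + suc p ℤ.* + N ℤ.* + t) (sym (ℕₚ.*-identityʳ (suc q))))) ⟩
    (+ suc p / suc q) * ⌜ N ⌝
      ≡⟨ cong (_* ⌜ N ⌝) (ℚₚ.↥p/↧p≡p ε) ⟩
    ε * ⌜ N ⌝
      ∎
    where
    open ℚₚ.≤-Reasoning
    N = suc K ℕ.* suc q
    K*q<p*N : K ℕ.* suc q ℕ.< suc p ℕ.* N ℕ.* 1
    K*q<p*N = ℕₚ.≤-Reasoning.begin-strict
      K ℕ.* suc q           ℕₚ.≤-Reasoning.<⟨ ℕₚ.*-monoˡ-< (suc q) (ℕₚ.n<1+n K) ⟩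
      N                     ℕₚ.≤-Reasoning.≤⟨ ℕₚ.m≤n*m N (suc p) ⟩
      suc p ℕ.* N           ℕₚ.≤-Reasoning.≡⟨ sym (ℕₚ.*-identityʳ _) ⟩
      suc p ℕ.* N ℕ.* 1     ℕₚ.≤-Reasoning.∎
    pos-** : + (suc p ℕ.* N ℕ.* 1) ≡ (+ suc p ℤ.* + N) ℤ.* + 1
    pos-** = trans (ℤₚ.pos-* (suc p ℕ.* N) 1) (cong (ℤ._* + 1) (ℤₚ.pos-* (suc p) N))
  archimedean K (mkℚ (+ 0)     _ _) (*<* (+<+ ()))
  archimedean K (mkℚ -[1+ _ ]  _ _) (*<* ())

  ⌜⌝-* : ∀ m n → ⌜ m ⌝ * ⌜ n ⌝ ≡ ⌜ m ℕ.* n ⌝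
  ⌜⌝-* m n = ℕ/-*-ℕ/ m n (m ℕ.* n) 1 1 1 refl

  Converges1/N⇒converges : ∀ {a L} → Converges1/N a L →
                           (ε : ℚ) → 0ℚ < ε → ∃ λ N → (n : ℕ) → N ℕ.≤ n → ∣ a n - L ∣ < ε
  Converges1/N⇒converges {a} {L} (K , I , bound) ε ε>0 = I ⊔ N₀ , close
    where
    N₀ = suc K ℕ.* ↧ₙ ε
    instance
      ε-nonNeg : NonNegative ε
      ε-nonNeg = ℚₚ.pos⇒nonNeg ε {{positive ε>0}}
    close : ∀ n → I ⊔ N₀ ℕ.≤ n → ∣ a n - L ∣ < ε
    close n n≥ = ℚₚ.*-cancelʳ-<-nonNeg ⌜ n ⌝ {{⌜⌝-nonNeg n}} (begin-strict
      ∣ a n - L ∣ * ⌜ n ⌝   ≤⟨ bound n (ℕₚ.m⊔n≤o⇒m≤o I N₀ n≥) ⟩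
      ⌜ K ⌝                 <⟨ archimedean K ε ε>0 ⟩
      ε * ⌜ N₀ ⌝            ≤⟨ ℚₚ.*-monoˡ-≤-nonNeg ε (⌜⌝-mono-≤ N₀≤n) ⟩
      ε * ⌜ n ⌝             ∎)
      where
      open ℚₚ.≤-Reasoning
      N₀≤n = ℕₚ.m⊔n≤o⇒n≤o I N₀ n≥

  Converges1/N-cong : ∀ {a b L M} → a ≗ b → L ≡ M → Converges1/N a L → Converges1/N b M
  Converges1/N-cong {L = L} a≗b refl (K , I , bound) =
    K , I , λ N N≥ → subst (λ t → ∣ t - L ∣ * ⌜ N ⌝ ≤ ⌜ K ⌝) (a≗b N) (bound N N≥)

  Converges1/N-+ : ∀ {a b L M} → Converges1/N a L → Converges1/N b M →
                   Converges1/N (λ N → a N + b N) (L + M)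
  Converges1/N-+ {a} {b} {L} {M} (K₁ , I₁ , bound₁) (K₂ , I₂ , bound₂) = K₁ ℕ.+ K₂ , I₁ ⊔ I₂ , bound
    where
    open ℚₚ.≤-Reasoning
    open +-*-Solver
    regroup : ∀ x y u v → (x + y) - (u + v) ≡ (x - u) + (y - v)
    regroup = solve 4 (λ x y u v → (x :+ y) :- (u :+ v) := (x :- u) :+ (y :- v)) refl
    bound : ∀ N → I₁ ⊔ I₂ ℕ.≤ N → ∣ (a N + b N) - (L + M) ∣ * ⌜ N ⌝ ≤ ⌜ K₁ ℕ.+ K₂ ⌝
    bound N N≥ = begin
      ∣ (a N + b N) - (L + M) ∣ * ⌜ N ⌝
        ≡⟨ cong (λ t → ∣ t ∣ * ⌜ N ⌝) (regroup (a N) (b N) L M) ⟩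
      ∣ (a N - L) + (b N - M) ∣ * ⌜ N ⌝
        ≤⟨ ℚₚ.*-monoʳ-≤-nonNeg ⌜ N ⌝ {{⌜⌝-nonNeg N}}
                               (ℚₚ.∣p+q∣≤∣p∣+∣q∣ (a N - L) (b N - M)) ⟩
      (∣ a N - L ∣ + ∣ b N - M ∣) * ⌜ N ⌝
        ≡⟨ ℚₚ.*-distribʳ-+ ⌜ N ⌝ ∣ a N - L ∣ ∣ b N - M ∣ ⟩
      ∣ a N - L ∣ * ⌜ N ⌝ + ∣ b N - M ∣ * ⌜ N ⌝
        ≤⟨ ℚₚ.+-mono-≤ (bound₁ N (ℕₚ.m⊔n≤o⇒m≤o I₁ I₂ N≥))
                       (bound₂ N (ℕₚ.m⊔n≤o⇒n≤o I₁ I₂ N≥)) ⟩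
      ⌜ K₁ ⌝ + ⌜ K₂ ⌝
        ≡⟨ ⌜⌝-+ K₁ K₂ ⟩
      ⌜ K₁ ℕ.+ K₂ ⌝
        ∎

  Converges1/N-*ˡ : ∀ z {a L} → Converges1/N a L →
                    Converges1/N (λ N → (z / 1) * a N) ((z / 1) * L)
  Converges1/N-*ˡ z {a} {L} (K , I , bound) = ℤ.∣ z ∣ ℕ.* K , I , scaled
    where
    open ℚₚ.≤-Reasoning
    open +-*-Solver
    c = z / 1
    factor : ∀ x y u → x * y - x * u ≡ x * (y - u)
    factor = solve 3 (λ x y u → x :* y :- x :* u := x :* (y :- u)) refl
    scaled : ∀ N → I ℕ.≤ N → ∣ c * a N - c * L ∣ * ⌜ N ⌝ ≤ ⌜ ℤ.∣ z ∣ ℕ.* K ⌝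
    scaled N N≥ = begin
      ∣ c * a N - c * L ∣ * ⌜ N ⌝
        ≡⟨ cong (λ t → ∣ t ∣ * ⌜ N ⌝) (factor c (a N) L) ⟩
      ∣ c * (a N - L) ∣ * ⌜ N ⌝
        ≡⟨ cong (_* ⌜ N ⌝) (ℚₚ.∣p*q∣≡∣p∣*∣q∣ c (a N - L)) ⟩
      ∣ c ∣ * ∣ a N - L ∣ * ⌜ N ⌝
        ≡⟨ ℚₚ.*-assoc ∣ c ∣ ∣ a N - L ∣ ⌜ N ⌝ ⟩
      ∣ c ∣ * (∣ a N - L ∣ * ⌜ N ⌝)
        ≤⟨ ℚₚ.*-monoˡ-≤-nonNeg ∣ c ∣ {{ℚₚ.∣-∣-nonNeg c}} (bound N N≥) ⟩
      ∣ c ∣ * ⌜ K ⌝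
        ≡⟨ cong (_* ⌜ K ⌝) (∣/∣ z 1) ⟩
      ⌜ ℤ.∣ z ∣ ⌝ * ⌜ K ⌝
        ≡⟨ ⌜⌝-* ℤ.∣ z ∣ K ⟩
      ⌜ ℤ.∣ z ∣ ℕ.* K ⌝
        ∎

  Converges1/N-∑≤ : ∀ K (f : ℕ → ℕ → ℚ) (L : ℕ → ℚ) →
                    (∀ m → m ℕ.≤ K → Converges1/N (f m) (L m)) →
                    Converges1/N (λ N → ∑[ m ≤ K ] f m N) (∑[ m ≤ K ] L m)
  Converges1/N-∑≤ zero    f L conv = conv 0 z≤n
  Converges1/N-∑≤ (suc K) f L conv =
    Converges1/N-+ {a = λ N → ∑[ m ≤ K ] f m N} {b = f (suc K)}
                   (Converges1/N-∑≤ K f L (λ m m≤K → conv m (ℕₚ.m≤n⇒m≤1+n m≤K)))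
                   (conv (suc K) ℕₚ.≤-refl)

module PowExpSeries where

  open BinomialConvolution using (powExp)
  open Absorption using ([k+1]*[n+1]C[k+1]≡[n+1]*nCk)
  open Fractions
  open RateOfConvergence
  open import Data.Nat using (_+_; _*_; _^_; _∸_; _!; _≤_)
  open import Data.Nat.Combinatorics using (_C_)
  open import Data.Nat.Tactic.RingSolver using (solve-∀)
  open import Data.Integer as ℤ using (+_)
  import Data.Integer.Properties as ℤₚ
  open import Data.Rational as ℚ using (ℚ; _/_; ∣_∣)
  import Data.Rational.Properties as ℚₚ
  open import Data.Rational.Solver using (module +-*-Solver)
  open import Data.Product using (_,_)
  open import Relation.Binary.PropositionalEquality

  powExp-closed : ∀ i r n → powExp i r n ≡ + (i ! * ((n C i) * r ^ (n ∸ i)))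
  powExp-closed zero    r n       = cong +_ (sym (trans (ℕₚ.+-identityʳ _) (ℕₚ.*-identityˡ _)))
  powExp-closed (suc i) r zero    = cong +_ (sym (ℕₚ.*-zeroʳ (suc i !)))
  powExp-closed (suc i) r (suc n) = begin
    + suc n ℤ.* powExp i r n
      ≡⟨ cong (+ suc n ℤ.*_) (powExp-closed i r n) ⟩
    + suc n ℤ.* + (i ! * ((n C i) * R))
      ≡⟨ sym (ℤₚ.pos-* (suc n) _) ⟩
    + (suc n * (i ! * ((n C i) * R)))
      ≡⟨ cong +_ (regroup (suc n) (i !) (n C i) R) ⟩
    + (i ! * ((suc n * (n C i)) * R))
      ≡⟨ cong (λ t → + (i ! * (t * R))) (sym ([k+1]*[n+1]C[k+1]≡[n+1]*nCk n i)) ⟩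
    + (i ! * ((suc i * (suc n C suc i)) * R))
      ≡⟨ cong +_ (regroup′ (i !) i (suc n C suc i) R) ⟩
    + (suc i ! * ((suc n C suc i) * R))
      ∎
    where
    open ≡-Reasoning
    R = r ^ (n ∸ i)
    regroup : ∀ n f c R → n * (f * (c * R)) ≡ f * ((n * c) * R)
    regroup = solve-∀
    regroup′ : ∀ f i c R → f * ((suc i * c) * R) ≡ (suc i * f) * (c * R)
    regroup′ = solve-∀

  partialSum : (i r d : ℕ) .{{_ : NonZero d}} → ℕ → ℚ
  partialSum i r d N = ∑[ n ≤ N ] term n
    where
    term : ℕ → ℚ
    term n = powExp i r n / d ^ n
      where instance _ = ℕₚ.m^n≢0 d n

  limit : (i s d : ℕ) .{{_ : NonZero s}} → ℚ
  limit i s d = + (i ! * d) / s ^ suc i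
    where instance _ = ℕₚ.m^n≢0 s (suc i)

  module _ (i r s d : ℕ) .{{_ : NonZero s}} .{{_ : NonZero d}} (r+s≡d : r + s ≡ d) where

    open NegativeBinomialTail r s
      using (horner; lowerTail; horner-identity; tailConstant; suc-*-lowerTail≤)

    horner-identity′ : ∀ M → s ^ suc i * horner i M + lowerTail i M ≡ d ^ M
    horner-identity′ M = subst (λ t → s ^ suc i * horner i M + lowerTail i M ≡ t ^ M) r+s≡d (horner-identity i M)

    partialSum-closed : ∀ N → partialSum i r d N ≡ (+ (i ! * horner i (suc N)) / d ^ N) {{ℕₚ.m^n≢0 d N}}
    partialSum-closed zero    = cong (_/ 1) (powExp-closed i r 0)
    partialSum-closed (suc N) = begin
      partialSum i r d N ℚ.+ powExp i r (suc N) / d ^ suc N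
        ≡⟨ cong₂ ℚ._+_ (partialSum-closed N) (cong (_/ d ^ suc N) (powExp-closed i r (suc N))) ⟩
      + (i ! * H) / d ^ N ℚ.+ + (i ! * G) / d ^ suc N
        ≡⟨ ℕ/-+-ℕ/ (i ! * H) (i ! * G) (i ! * horner i (suc (suc N))) (d ^ N) (d ^ suc N) (d ^ suc N) cross ⟩
      + (i ! * horner i (suc (suc N))) / d ^ suc N
        ∎
      where
      open ≡-Reasoning
      instance
        _ = ℕₚ.m^n≢0 d N
        _ = ℕₚ.m^n≢0 d (suc N)
      H = horner i (suc N)
      G = (suc N C i) * r ^ (suc N ∸ i)
      regroup : ∀ f H G d D → (f * H * (d * D) + f * G * D) * (d * D) ≡ f * (H * d + G) * (D * (d * D))
      regroup = solve-∀
      cross : (i ! * H * d ^ suc N + i ! * G * d ^ N) * d ^ suc N ≡ i ! * (H * (r + s) + G) * (d ^ N * d ^ suc N)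
      cross = subst (λ t → (i ! * H * d ^ suc N + i ! * G * d ^ N) * d ^ suc N ≡
                           i ! * (H * t + G) * (d ^ N * d ^ suc N))
                    (sym r+s≡d) (regroup (i !) H G d (d ^ N))

    tailTerm : ℕ → ℚ
    tailTerm N = + (i ! * lowerTail i (suc N)) / (s ^ suc i * d ^ N)
      where instance _ = ℕₚ.m*n≢0 (s ^ suc i) (d ^ N) {{ℕₚ.m^n≢0 s (suc i)}} {{ℕₚ.m^n≢0 d N}}

    limit-split : ∀ N → limit i s d ≡ partialSum i r d N ℚ.+ tailTerm N
    limit-split N = sym (begin
      partialSum i r d N ℚ.+ tailTerm N
        ≡⟨ cong (ℚ._+ tailTerm N) (partialSum-closed N) ⟩
      + (i ! * H) / D ℚ.+ + (i ! * L′) / (S * D)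
        ≡⟨ ℕ/-+-ℕ/ (i ! * H) (i ! * L′) (i ! * d) D (S * D) S cross ⟩
      limit i s d
        ∎)
      where
      open ≡-Reasoning
      H  = horner i (suc N)
      L′ = lowerTail i (suc N)
      S  = s ^ suc i
      D  = d ^ N
      instance
        _ = ℕₚ.m^n≢0 d N
        _ = ℕₚ.m^n≢0 s (suc i)
        _ = ℕₚ.m*n≢0 S D
      regroup : ∀ f H S D L → (f * H * (S * D) + f * L * D) * S ≡ f * D * S * (S * H + L)
      regroup = solve-∀
      regroup′ : ∀ f D S d → f * D * S * (d * D) ≡ f * d * (D * (S * D))
      regroup′ = solve-∀
      cross : (i ! * H * (S * D) + i ! * L′ * D) * S ≡ i ! * d * (D * (S * D))
      cross = trans (regroup (i !) H S D L′)
                    (trans (cong (i ! * D * S *_) (horner-identity′ (suc N))) (regroup′ (i !) D S d))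

    errorBound : ℕ
    errorBound = i ! * tailConstant i * d * d

    N*tail≤errorBound : ∀ N → i ! * lowerTail i (suc N) * N * 1 ≤ errorBound * (s ^ suc i * d ^ N)
    N*tail≤errorBound N = begin
      i ! * L′ * N * 1                         ≡⟨ regroup (i !) L′ N ⟩
      i ! * (N * L′)                           ≤⟨ ℕₚ.*-monoʳ-≤ (i !) (ℕₚ.*-monoˡ-≤ L′ N≤2+N) ⟩
      i ! * (suc (suc N) * L′)                 ≤⟨ ℕₚ.*-monoʳ-≤ (i !) tail-bound ⟩
      i ! * (tailConstant i * (d * (d * D)))   ≡⟨ regroup′ (i !) (tailConstant i) d D ⟩
      errorBound * D                           ≤⟨ ℕₚ.*-monoʳ-≤ errorBound (ℕₚ.m≤n*m D (s ^ suc i)) ⟩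
      errorBound * (s ^ suc i * D)             ∎
      where
      open ℕₚ.≤-Reasoning
      instance _ = ℕₚ.m^n≢0 s (suc i)
      L′ = lowerTail i (suc N)
      D  = d ^ N
      N≤2+N = ℕₚ.m≤n⇒m≤1+n (ℕₚ.n≤1+n N)
      tail-bound : suc (suc N) * L′ ≤ tailConstant i * (d * (d * D))
      tail-bound = subst (λ t → suc (suc N) * L′ ≤ tailConstant i * t ^ suc (suc N)) r+s≡d
                         (suc-*-lowerTail≤ i (suc N))
      regroup : ∀ f L N → f * L * N * 1 ≡ f * (N * L)
      regroup = solve-∀
      regroup′ : ∀ f T d D → f * (T * (d * (d * D))) ≡ f * T * d * d * D
      regroup′ = solve-∀

    partialSum-error : ∀ N → ∣ partialSum i r d N ℚ.- limit i s d ∣ ℚ.* ⌜ N ⌝ ℚ.≤ ⌜ errorBound ⌝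
    partialSum-error N = begin
      ∣ P ℚ.- limit i s d ∣ ℚ.* ⌜ N ⌝
        ≡⟨ cong (λ t → ∣ P ℚ.- t ∣ ℚ.* ⌜ N ⌝) (limit-split N) ⟩
      ∣ P ℚ.- (P ℚ.+ tailTerm N) ∣ ℚ.* ⌜ N ⌝
        ≡⟨ cong (λ t → ∣ t ∣ ℚ.* ⌜ N ⌝) (cancel P (tailTerm N)) ⟩
      ∣ ℚ.- tailTerm N ∣ ℚ.* ⌜ N ⌝
        ≡⟨ cong (ℚ._* ⌜ N ⌝) (trans (ℚₚ.∣-p∣≡∣p∣ (tailTerm N))
                                    (∣/∣ (+ (i ! * L′)) (S * D))) ⟩
      tailTerm N ℚ.* ⌜ N ⌝
        ≡⟨ ℕ/-*-ℕ/ (i ! * L′) N (i ! * L′ * N) (S * D) 1 (S * D)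
                   (cong (i ! * L′ * N *_) (sym (ℕₚ.*-identityʳ (S * D)))) ⟩
      + (i ! * L′ * N) / (S * D)
        ≤⟨ ℕ/-≤-ℕ/ (i ! * L′ * N) errorBound (S * D) 1 (N*tail≤errorBound N) ⟩
      ⌜ errorBound ⌝
        ∎
      where
      open ℚₚ.≤-Reasoning
      open +-*-Solver using (solve; _:+_; _:-_; :-_; _:=_)
      P  = partialSum i r d N
      L′ = lowerTail i (suc N)
      S  = s ^ suc i
      D  = d ^ N
      instance
        _ = ℕₚ.m*n≢0 S D {{ℕₚ.m^n≢0 s (suc i)}} {{ℕₚ.m^n≢0 d N}}
      cancel : ∀ p e → p ℚ.- (p ℚ.+ e) ≡ ℚ.- e
      cancel = solve 2 (λ p e → p :- (p :+ e) := :- e) refl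

    converges : Converges1/N (partialSum i r d) (limit i s d)
    converges = errorBound , 0 , λ N _ → partialSum-error N

module Expectation (k : ℕ) where

  open BinomialConvolution using (x·_; x·-cong)
  open StoppingCount using (stops; stops-formula)
  open ClosedForm using (Φ; χ≥2^⋆≗Φ; coefficient; x·x·Φ)
  open Fractions
  open RateOfConvergence
  open PowExpSeries using (partialSum; limit; converges)
  open import Data.Nat using (_∸_; _^_; _!)
  open import Data.Nat.Combinatorics using (_C_)
  open import Data.Integer as ℤ using (ℤ; +_)
  import Data.Integer.Properties as ℤₚ
  open import Data.Integer.Tactic.RingSolver using (solve-∀)
  open import Data.Rational as ℚ using (ℚ; _/_)
  import Data.Rational.Properties as ℚₚ
  open import Relation.Binary.PropositionalEquality
  module ℤΣ = RangeSum ℤₚ.+-*-commutativeSemiring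

  d : ℕ
  d = suc k

  term : ℕ → ℚ
  term n = ⌜ n ⌝ ℚ.* probT₂ d n

  sumTo≡∑≤ : ∀ K f → sumTo K f ≡ ∑≤ K f
  sumTo≡∑≤ zero    f = refl
  sumTo≡∑≤ (suc K) f = cong (ℚ._+ f (suc K)) (sumTo≡∑≤ K f)

  ∑≤-/ : ∀ K (f : ℕ → ℤ) D .{{_ : NonZero D}} → ℤΣ.∑≤ K f / D ≡ ∑[ i ≤ K ] (f i / D)
  ∑≤-/ zero    f D = refl
  ∑≤-/ (suc K) f D = trans (+-/ (ℤΣ.∑≤ K f) (f (suc K)) D) (cong (ℚ._+ f (suc K) / D) (∑≤-/ K f D))

  //≡/ : ∀ p a .{{_ : NonZero a}} → p // a ≡ p / a
  //≡/ p (suc a) = refl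

  n*stops : ∀ n → + n ℤ.* + stops d n ≡ + d ℤ.* (x· x· Φ k) n
  n*stops zero    = sym (ℤₚ.*-zeroʳ (+ d))
  n*stops (suc n) = begin
    + suc n ℤ.* + stops d (suc n)
      ≡⟨ cong (+ suc n ℤ.*_) (stops-formula k n) ⟩
    + suc n ℤ.* (+ d ℤ.* (x· (χ≥2 ^⋆ k)) n)
      ≡⟨ leftSwap (+ suc n) (+ d) _ ⟩
    + d ℤ.* (x· x· (χ≥2 ^⋆ k)) (suc n)
      ≡⟨ cong (+ d ℤ.*_) (x·-cong (x·-cong (χ≥2^⋆≗Φ k)) (suc n)) ⟩
    + d ℤ.* (x· x· Φ k) (suc n)
      ∎
    where
    open ≡-Reasoning
    open StoppingCount using (χ≥2; _^⋆_)
    leftSwap : ∀ x y z → x ℤ.* (y ℤ.* z) ≡ y ℤ.* (x ℤ.* z)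
    leftSwap = solve-∀

  powExpTerm : ℕ → ℕ → ℕ → ℚ
  powExpTerm m j n = powExp (2 ℕ.+ j) (k ∸ m) n / d ^ n
    where
    open BinomialConvolution using (powExp)
    instance _ = ℕₚ.m^n≢0 d n

  term-expansion : ∀ n →
    term n ≡ ⌜ d ⌝ ℚ.* ∑[ m ≤ k ] ∑[ j ≤ m ] ((coefficient k m j / 1) ℚ.* powExpTerm m j n)
  term-expansion n = begin
    ⌜ n ⌝ ℚ.* (+ stops d n / d ^ n)
      ≡⟨ /-*-/ (+ n) (+ stops d n) (+ d ℤ.* (x· x· Φ k) n) 1 (d ^ n) (d ^ n)
               (cong₂ (λ x y → x ℤ.* + y) (n*stops n) (sym (ℕₚ.*-identityˡ (d ^ n)))) ⟩
    (+ d ℤ.* (x· x· Φ k) n) / d ^ n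
      ≡⟨ *-/ (+ d) ((x· x· Φ k) n) (d ^ n) ⟩
    ⌜ d ⌝ ℚ.* ((x· x· Φ k) n / d ^ n)
      ≡⟨ cong (λ t → ⌜ d ⌝ ℚ.* (t / d ^ n)) (x·x·Φ k n) ⟩
    ⌜ d ⌝ ℚ.* (ℤΣ.∑≤ k (λ m → ℤΣ.∑≤ m (λ j → coefficient k m j ℤ.* p m j)) / d ^ n)
      ≡⟨ cong (⌜ d ⌝ ℚ.*_) (trans (∑≤-/ k _ (d ^ n)) (∑≤-cong k λ m _ →
           trans (∑≤-/ m _ (d ^ n)) (∑≤-cong m λ j _ → *-/ (coefficient k m j) (p m j) (d ^ n)))) ⟩
    ⌜ d ⌝ ℚ.* ∑[ m ≤ k ] ∑[ j ≤ m ] ((coefficient k m j / 1) ℚ.* powExpTerm m j n)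
      ∎
    where
    open ≡-Reasoning
    open BinomialConvolution using (powExp)
    instance _ = ℕₚ.m^n≢0 d n
    p : ℕ → ℕ → ℤ
    p m j = powExp (2 ℕ.+ j) (k ∸ m) n

  partialSums-expansion : ∀ N → sumTo N term ≡
    ⌜ d ⌝ ℚ.* ∑[ m ≤ k ] ∑[ j ≤ m ] ((coefficient k m j / 1) ℚ.* partialSum (2 ℕ.+ j) (k ∸ m) d N)
  partialSums-expansion N = begin
    sumTo N term
      ≡⟨ sumTo≡∑≤ N term ⟩
    ∑[ n ≤ N ] term n
      ≡⟨ ∑≤-cong N (λ n _ → term-expansion n) ⟩
    ∑[ n ≤ N ] (⌜ d ⌝ ℚ.* ∑[ m ≤ k ] ∑[ j ≤ m ] (c m j ℚ.* powExpTerm m j n))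
      ≡⟨ sym (*-distribˡ-∑≤ N ⌜ d ⌝ _) ⟩
    ⌜ d ⌝ ℚ.* ∑[ n ≤ N ] ∑[ m ≤ k ] ∑[ j ≤ m ] (c m j ℚ.* powExpTerm m j n)
      ≡⟨ cong (⌜ d ⌝ ℚ.*_) (trans (∑≤-comm N k _) (∑≤-cong k λ m _ →
           trans (∑≤-comm N m _)
                 (∑≤-cong m λ j _ → sym (*-distribˡ-∑≤ N (c m j) (powExpTerm m j))))) ⟩
    ⌜ d ⌝ ℚ.* ∑[ m ≤ k ] ∑[ j ≤ m ] (c m j ℚ.* partialSum (2 ℕ.+ j) (k ∸ m) d N)
      ∎
    where
    open ≡-Reasoning
    c : ℕ → ℕ → ℚ
    c m j = coefficient k m j / 1

  limitValue : ℚ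
  limitValue = ⌜ d ⌝ ℚ.* ∑[ m ≤ k ] ∑[ j ≤ m ] ((coefficient k m j / 1) ℚ.* limit (2 ℕ.+ j) (suc m) d)

  expectation-converges : Converges1/N (λ N → sumTo N term) limitValue
  expectation-converges =
    Converges1/N-cong (λ N → sym (partialSums-expansion N)) refl
      (Converges1/N-*ˡ (+ d) (Converges1/N-∑≤ k _ _ λ m m≤k → Converges1/N-∑≤ m _ _ λ j _ →
        Converges1/N-*ˡ (coefficient k m j) (converges (2 ℕ.+ j) (k ∸ m) (suc m) d (∸+suc m≤k))))
    where
    ∸+suc : ∀ {m} → m ℕ.≤ k → k ∸ m ℕ.+ suc m ≡ d
    ∸+suc {m} m≤k = trans (ℕₚ.+-suc (k ∸ m) m) (cong suc (ℕₚ.m∸n+n≡m m≤k))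

  summand : ℕ → ℕ → ℚ
  summand m j = (sign m ℤ.* (+ ((k C m) ℕ.* (m C j) ℕ.* ((j ℕ.+ 2) !)))) // (suc m ^ (j ℕ.+ 3))

  limit-summand : ∀ m j → (coefficient k m j / 1) ℚ.* limit (2 ℕ.+ j) (suc m) d ≡ ⌜ d ⌝ ℚ.* summand m j
  limit-summand m j = begin
    (sign m ℤ.* + (a ℕ.* b) / 1) ℚ.* (+ (f ℕ.* d) / S)
      ≡⟨ /-*-/ (sign m ℤ.* + (a ℕ.* b)) (+ (f ℕ.* d)) (+ d ℤ.* (sign m ℤ.* + (a ℕ.* b ℕ.* f)))
               1 S S cross ⟩
    (+ d ℤ.* (sign m ℤ.* + (a ℕ.* b ℕ.* f))) / S
      ≡⟨ *-/ (+ d) (sign m ℤ.* + (a ℕ.* b ℕ.* f)) S ⟩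
    ⌜ d ⌝ ℚ.* ((sign m ℤ.* + (a ℕ.* b ℕ.* f)) / S)
      ≡⟨ cong₂ (λ e e′ → ⌜ d ⌝ ℚ.* (_/_ (sign m ℤ.* + (a ℕ.* b ℕ.* (e !))) (suc m ^ e′)
                                       {{ℕₚ.m^n≢0 (suc m) e′}}))
               (ℕₚ.+-comm 2 j) (ℕₚ.+-comm 3 j) ⟩
    ⌜ d ⌝ ℚ.* ((sign m ℤ.* + (a ℕ.* b ℕ.* ((j ℕ.+ 2) !))) / suc m ^ (j ℕ.+ 3))
      ≡⟨ cong (⌜ d ⌝ ℚ.*_) (sym (//≡/ (sign m ℤ.* + (a ℕ.* b ℕ.* ((j ℕ.+ 2) !)))
                                       (suc m ^ (j ℕ.+ 3)))) ⟩
    ⌜ d ⌝ ℚ.* summand m j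
      ∎
    where
    open ≡-Reasoning
    a = k C m
    b = m C j
    f = (2 ℕ.+ j) !
    S = suc m ^ (3 ℕ.+ j)
    instance
      _ = ℕₚ.m^n≢0 (suc m) (3 ℕ.+ j)
      _ = ℕₚ.m^n≢0 (suc m) (j ℕ.+ 3)
    regroup : ∀ s A F D P → s ℤ.* A ℤ.* (F ℤ.* D) ℤ.* P ≡ D ℤ.* (s ℤ.* (A ℤ.* F)) ℤ.* P
    regroup = solve-∀
    cross : sign m ℤ.* + (a ℕ.* b) ℤ.* + (f ℕ.* d) ℤ.* + S ≡
            + d ℤ.* (sign m ℤ.* + (a ℕ.* b ℕ.* f)) ℤ.* + (1 ℕ.* S)
    cross = begin
      sign m ℤ.* + (a ℕ.* b) ℤ.* + (f ℕ.* d) ℤ.* + S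
        ≡⟨ cong (λ t → sign m ℤ.* + (a ℕ.* b) ℤ.* t ℤ.* + S) (ℤₚ.pos-* f d) ⟩
      sign m ℤ.* + (a ℕ.* b) ℤ.* (+ f ℤ.* + d) ℤ.* + S
        ≡⟨ regroup (sign m) (+ (a ℕ.* b)) (+ f) (+ d) (+ S) ⟩
      + d ℤ.* (sign m ℤ.* (+ (a ℕ.* b) ℤ.* + f)) ℤ.* + S
        ≡⟨ cong₂ (λ x y → + d ℤ.* (sign m ℤ.* x) ℤ.* + y)
                 (sym (ℤₚ.pos-* (a ℕ.* b) f)) (sym (ℕₚ.*-identityˡ S)) ⟩
      + d ℤ.* (sign m ℤ.* + (a ℕ.* b ℕ.* f)) ℤ.* + (1 ℕ.* S)
        ∎

  limitValue≡formula : limitValue ≡ formula d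
  limitValue≡formula = begin
    ⌜ d ⌝ ℚ.* ∑[ m ≤ k ] ∑[ j ≤ m ] ((coefficient k m j / 1) ℚ.* limit (2 ℕ.+ j) (suc m) d)
      ≡⟨ cong (⌜ d ⌝ ℚ.*_) (∑≤-cong k λ m _ → ∑≤-cong m λ j _ → limit-summand m j) ⟩
    ⌜ d ⌝ ℚ.* ∑[ m ≤ k ] ∑[ j ≤ m ] (⌜ d ⌝ ℚ.* summand m j)
      ≡⟨ cong (⌜ d ⌝ ℚ.*_) (trans (∑≤-cong k λ m _ → sym (*-distribˡ-∑≤ m ⌜ d ⌝ (summand m)))
                                  (sym (*-distribˡ-∑≤ k ⌜ d ⌝ _))) ⟩
    ⌜ d ⌝ ℚ.* (⌜ d ⌝ ℚ.* ∑[ m ≤ k ] ∑[ j ≤ m ] summand m j)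
      ≡⟨ sym (ℚₚ.*-assoc ⌜ d ⌝ ⌜ d ⌝ _) ⟩
    ⌜ d ⌝ ℚ.* ⌜ d ⌝ ℚ.* ∑[ m ≤ k ] ∑[ j ≤ m ] summand m j
      ≡⟨ cong₂ ℚ._*_ (trans (⌜⌝-* d d) (cong (λ t → ⌜ d ℕ.* t ⌝) (sym (ℕₚ.*-identityʳ d))))
                     (sym (trans (sumTo≡∑≤ k _) (∑≤-cong k λ m _ → sumTo≡∑≤ m (summand m)))) ⟩
    formula d
      ∎
    where open ≡-Reasoning

mainTheorem6 : (d : ℕ) → .{{_ : NonZero d}} → ExpectationT₂Is d (formula d)
mainTheorem6 (suc k) =
  subst (ExpectationT₂Is (suc k)) limitValue≡formula
        (Converges1/N⇒converges {λ N → sumTo N term} expectation-converges)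
  where
  open import Relation.Binary.PropositionalEquality using (subst)
  open RateOfConvergence using (Converges1/N⇒converges)
  open Expectation k using (term; limitValue≡formula; expectation-converges)
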